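{- Let $d\in\{2,7,11,19,43,67,163\}$, $K=\mathbb{Q}(\sqrt{ -d})$ (class number $1$), and let $\phi$ be the Hecke character of weight $3$ with modulus $\Lambda=(1)$, i.e. the homomorphism from the group of nonzero fractional ideals of $K$ to $\mathbb{C}^\times$ with $\phi(\alpha\mathcal{O}_K)=\alpha^{2}$ for all $\alpha\in K^\times$. Let $\Psi_{K,\Lambda}(q)=\sum_{A}\phi(A)q^{N(A)}$, the sum over all nonzero integral ideals $A$ of $K$. Let $L_{\mathfrak{o}}\subset\mathbb{R}^2$ be $\mathcal{O}_K$ under the identification $\mathbb{C}\cong\mathbb{R}^2$, $a+bi\mapsto (a,b)$, and $P_1(x,y)=(x^2-y^2)/2$. Then, as power series in $q$, $\Psi_{K,\Lambda}(q)=\Theta_{L_{\mathfrak{o}},P_1}(q):=\sum_{v\in L_{\mathfrak{o}}}P_1(v)\,q^{(v,v)}$.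
   Context: $(\cdot,\cdot)$ is the standard Euclidean inner product on $\mathbb{R}^2$, so $(v,v)=N_{K/\mathbb{Q}}(v)$ for $v\in\mathcal{O}_K$. $N(A)$ is the absolute norm of the ideal $A$. Both sides are viewed as formal power series (or as functions of $z$ in the upper half plane with $q=e^{\pi i z}$). -}

module Defs where

open import Data.Nat as ℕ using (ℕ; suc)
open import Data.Integer as ℤ using (ℤ; +_)
open import Data.Rational as ℚ using (ℚ; ½)
open import Data.Product using (_×_; _,_; Σ; proj₁; proj₂)
open import Data.List using (List; []; _∷_)
open import Relation.Binary.PropositionalEquality using (_≡_)

data D : Set where
  d2 d7 d11 d19 d43 d67 d163 : D

val : D → ℕ
val d2   = 2
val d7   = 7
val d11  = 11
val d19  = 19
val d43  = 43
val d67  = 67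
val d163 = 163

-- Elements of O_K, K = Q(sqrt(-d)), in the Z-basis (1, ω):
--   (x , y) represents x + y ω, where
--   ω = sqrt(-2)            if d = 2        (O_K = Z[sqrt(-2)])
--   ω = (1 + sqrt(-d)) / 2  otherwise (d ≡ 3 mod 4).
OK : Set
OK = ℤ × ℤ

-- ω² = c0 + c1 ω
ωsq : D → ℤ × ℤ
ωsq d2 = (ℤ.- (+ 2) , + 0)
ωsq d  = (ℤ.- (+ ((1 ℕ.+ val d) ℕ./ 4)) , + 1)

_+O_ : OK → OK → OK
(x₁ , y₁) +O (x₂ , y₂) = (x₁ ℤ.+ x₂ , y₁ ℤ.+ y₂)

mulO : D → OK → OK → OK
mulO d (x₁ , y₁) (x₂ , y₂) =
  let yy = y₁ ℤ.* y₂ in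
  ( x₁ ℤ.* x₂ ℤ.+ yy ℤ.* proj₁ (ωsq d)
  , x₁ ℤ.* y₂ ℤ.+ x₂ ℤ.* y₁ ℤ.+ yy ℤ.* proj₂ (ωsq d) )

-- Elements of K = Q(sqrt(-d)) ⊂ ℂ: (u , w) represents u + w sqrt(-d)
-- = u + (w sqrt d) i, i.e. the point (u , w sqrt d) of R².
Kq : Set
Kq = ℚ × ℚ

embed : D → OK → Kq
embed d2 (x , y) = (x ℚ./ 1 , y ℚ./ 1)
embed d  (x , y) = (x ℚ./ 1 ℚ.+ ½ ℚ.* (y ℚ./ 1) , ½ ℚ.* (y ℚ./ 1))

dℚ : D → ℚ
dℚ d = (+ val d) ℚ./ 1

_+K_ : Kq → Kq → Kq
(u₁ , w₁) +K (u₂ , w₂) = (u₁ ℚ.+ u₂ , w₁ ℚ.+ w₂)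

0K : Kq
0K = (ℚ.0ℚ , ℚ.0ℚ)

-- squaring in K: (u + w sqrt(-d))² = (u² - d w²) + 2uw sqrt(-d)
sqK : D → Kq → Kq
sqK d (u , w) = (u ℚ.* u ℚ.- dℚ d ℚ.* (w ℚ.* w) , (+ 2 ℚ./ 1) ℚ.* (u ℚ.* w))

-- Real coordinates of v ∈ O_K ⊂ ℂ ≅ R²: v = (X , Y) with X = u, Y = w sqrt d.
-- (v , v) = X² + Y² = u² + d w².
ip : D → OK → ℚ
ip d v = let (u , w) = embed d v in u ℚ.* u ℚ.+ dℚ d ℚ.* (w ℚ.* w)

-- P₁(X , Y) = (X² - Y²)/2 = (u² - d w²)/2.
P₁ : D → OK → ℚ
P₁ d v = let (u , w) = embed d v in ½ ℚ.* (u ℚ.* u ℚ.- dℚ d ℚ.* (w ℚ.* w))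

-- Nonzero integral ideals of O_K are full-rank sublattices of O_K ≅ Z²,
-- each with a unique Hermite normal form basis { a , b + c ω } with
-- a ≥ 1, c ≥ 1, 0 ≤ b < a; its norm (index in O_K) is a·c.
InL : ℕ → ℕ → ℕ → OK → Set
InL a b c (x , y) =
  Σ ℤ λ m → Σ ℤ λ k → (x ≡ m ℤ.* + a ℤ.+ k ℤ.* + b) × (y ≡ k ℤ.* + c)

IsIdealHNF : D → ℕ × ℕ × ℕ → Set
IsIdealHNF d (a , b , c) =
  (1 ℕ.≤ a) × (1 ℕ.≤ c) × (b ℕ.< a) ×
  ((r z : OK) → InL a b c z → InL a b c (mulO d r z))

normI : ℕ × ℕ × ℕ → ℕ
normI (a , b , c) = a ℕ.* c

IsPrincipalGen : D → ℕ × ℕ × ℕ → OK → Set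
IsPrincipalGen d (a , b , c) α =
  (z : OK) → (InL a b c z → Σ OK λ β → z ≡ mulO d α β)
           × (Σ OK (λ β → z ≡ mulO d α β) → InL a b c z)

sumK : {A : Set} → (A → Kq) → List A → Kq
sumK f []       = 0K
sumK f (x ∷ xs) = f x +K sumK f xs

sumℚ : {A : Set} → (A → ℚ) → List A → ℚ
sumℚ f []       = ℚ.0ℚ
sumℚ f (x ∷ xs) = f x ℚ.+ sumℚ f xs

embedℕ : ℕ → ℚ
embedℕ n = (+ n) ℚ./ 1

module Submission where

-- Since ℤ[ω] has class number one, every nonzero ideal A of norm n is αℤ[ω] for an α of
-- norm n that is unique up to the units ±1, and φ(A) = α². Hence twice the coefficient of
-- qⁿ in Ψ is Σ_{N(v) = n} v², whose real part is 2 Σ P₁(v) and whose imaginary part cancels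
-- under v ↦ v̄. Principality comes from the reduction of binary quadratic forms: a lattice
-- aℤ + (b + ω)ℤ with a ∣ N(b + ω) and |2b + c₁| ≤ a is reduced to a₁ℤ + (b + ω)ℤ with
-- a₁ = N(b + ω)/a < a, unless (a, 2b + c₁, a₁) is a reduced form of discriminant −Δ other
-- than the principal one; a finite search rules such forms out for the seven values of d.

open import Defs
open import Data.Nat as ℕ using (ℕ; zero; suc; z≤n; s≤s)
import Data.Nat.Properties as ℕP
import Data.Nat.Divisibility as ℕ∣
open ℕ∣ using () renaming (_∣_ to _∣ℕ_; _∣?_ to _∣ℕ?_; ∣-antisym to ∣ℕ-antisym)
open import Data.Nat.GCD using (module Bézout; module GCD)
open import Data.Nat.Induction using (<-rec)
open import Data.Integer as ℤ using (ℤ; +_; -[1+_]; _+_; _*_; -_; _-_; ∣_∣)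
import Data.Integer.Properties as ℤP
open import Data.Integer.DivMod using (_%ℕ_; _/ℕ_; n%ℕd<d; a≡a%ℕn+[a/ℕn]*n)
open import Data.Integer.Divisibility.Signed using (_∣_; divides; ∣ᵤ⇒∣; ∣⇒∣ᵤ)
open import Data.Integer.Tactic.RingSolver using (solve-∀)
open import Data.Rational as ℚ using (ℚ; ½; 0ℚ; 1ℚ)
import Data.Rational.Properties as ℚP
open import Data.Rational.Unnormalised as ℚᵘ using (mkℚᵘ; *≡*)
import Data.Rational.Unnormalised.Properties as ℚᵘP
open import Data.Rational.Solver using (module +-*-Solver)
open import Data.Fin using (Fin; toℕ; fromℕ<)
import Data.Fin.Properties as FinP
open import Data.Product using (_×_; _,_; Σ; proj₁; proj₂)
open import Data.Sum using (_⊎_; inj₁; inj₂)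
open import Data.Empty using (⊥; ⊥-elim)
open import Data.List using (List; []; _∷_; map)
open import Data.List.Relation.Unary.All as All using (All; []; _∷_)
open import Data.List.Relation.Unary.Any using (here; there)
open import Data.List.Membership.Propositional using (_∈_)
open import Data.List.Membership.Propositional.Properties using (∈-map⁺; ∈-map⁻)
open import Data.List.Membership.Propositional.Properties.WithK using (unique∧set⇒bag)
open import Data.List.Relation.Unary.Unique.Propositional using (Unique)
import Data.List.Relation.Unary.AllPairs as AllPairs
import Data.List.Relation.Unary.Unique.Propositional.Properties as Unique
open import Data.List.Relation.Binary.BagAndSetEquality using (∼bag⇒↭)
open import Data.List.Relation.Binary.Permutation.Propositional as ↭ using (_↭_)
open import Function.Bundles using (mk⇔)
open import Relation.Nullary using (¬_; Dec; yes; no; ¬?)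
open import Relation.Nullary.Decidable using (True; toWitness; _→-dec_)
open import Relation.Binary.PropositionalEquality
open +-*-Solver using (solve; _:=_; _:+_; _:*_; :-_; _:-_; con)

i-j≡k⇒i≡k+j : ∀ {i j k} → i - j ≡ k → i ≡ k + j
i-j≡k⇒i≡k+j {i} {j} refl = split i j
  where
  split : ∀ i j → i ≡ (i - j) + j
  split = solve-∀

i+j≡k⇒i≡k-j : ∀ {i j k} → i + j ≡ k → i ≡ k - j
i+j≡k⇒i≡k-j {i} {j} refl = split i j
  where
  split : ∀ i j → i ≡ (i + j) - j
  split = solve-∀

m*m≡0⇒m≡0 : ∀ m → m ℕ.* m ≡ 0 → m ≡ 0
m*m≡0⇒m≡0 zero    _ = refl
m*m≡0⇒m≡0 (suc m) ()

square-∣∣ : ∀ z → z * z ≡ + (∣ z ∣ ℕ.* ∣ z ∣)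
square-∣∣ (+ n)    = sym (ℤP.pos-* n n)
square-∣∣ -[1+ n ] = refl

∣i∣≡1⇒i≡±1 : ∀ k → ∣ k ∣ ≡ 1 → (k ≡ + 1) ⊎ (k ≡ -[1+ 0 ])
∣i∣≡1⇒i≡±1 (+ 1)    _ = inj₁ refl
∣i∣≡1⇒i≡±1 -[1+ 0 ] _ = inj₂ refl
∣i∣≡1⇒i≡±1 (+ 0) ()
∣i∣≡1⇒i≡±1 (+ suc (suc _)) ()
∣i∣≡1⇒i≡±1 -[1+ suc _ ] ()

signum : ∀ z → Σ ℤ λ σ → + ∣ z ∣ ≡ σ * z
signum (+ n)    = + 1 , sym (ℤP.*-identityˡ (+ n))
signum -[1+ n ] = - + 1 , sym (ℤP.-1*i≡-i -[1+ n ])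

lift-ℕ-identity : ∀ g m n {x y} σ z τ w → g ℕ.+ m ℕ.* x ≡ n ℕ.* y →
  + x ≡ σ * z → + y ≡ τ * w → + g + + m * (σ * z) ≡ + n * (τ * w)
lift-ℕ-identity g m n {x} {y} σ z τ w eq x≡ y≡ = subst₂ (λ X Y → + g + + m * X ≡ + n * Y) x≡ y≡
  (trans (cong (λ t → + g + t) (sym (ℤP.pos-* m x))) (trans (sym (ℤP.pos-+ g _)) (trans (cong +_ eq) (ℤP.pos-* n y))))

bézout : ∀ y z → Σ ℕ λ g → Σ ℤ λ P → Σ ℤ λ Q → (+ g ≡ P * y + Q * z) × (+ g ∣ y) × (+ g ∣ z)
bézout y z with Bézout.lemma ∣ y ∣ ∣ z ∣ | signum y | signum z
... | Bézout.result g gcd (Bézout.+- u v eq) | σ , ∣y∣≡ | τ , ∣z∣≡ =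
  g , + u * σ , - (+ v * τ) , trans (i+j≡k⇒i≡k-j (lift-ℕ-identity g v u τ z σ y eq ∣z∣≡ ∣y∣≡)) (regroup (+ u) σ y (+ v) τ z) ,
  ∣ᵤ⇒∣ (GCD.gcd∣m gcd) , ∣ᵤ⇒∣ (GCD.gcd∣n gcd)
  where
  regroup : ∀ u σ y v τ z → u * (σ * y) - v * (τ * z) ≡ u * σ * y + - (v * τ) * z
  regroup = solve-∀
... | Bézout.result g gcd (Bézout.-+ u v eq) | σ , ∣y∣≡ | τ , ∣z∣≡ =
  g , - (+ u * σ) , + v * τ , trans (i+j≡k⇒i≡k-j (lift-ℕ-identity g u v σ y τ z eq ∣y∣≡ ∣z∣≡)) (regroup (+ u) σ y (+ v) τ z) ,
  ∣ᵤ⇒∣ (GCD.gcd∣m gcd) , ∣ᵤ⇒∣ (GCD.gcd∣n gcd)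
  where
  regroup : ∀ u σ y v τ z → v * (τ * z) - u * (σ * y) ≡ - (u * σ) * y + v * τ * z
  regroup = solve-∀

det : OK → OK → ℤ
det (p₁ , p₂) (q₁ , q₂) = p₁ * q₂ - p₂ * q₁

-- Cramer's rule.
unimodular-coordinates : ∀ e₁ e₂ → det e₁ e₂ ≡ + 1 → ∀ β →
  Σ ℤ λ s → Σ ℤ λ k → β ≡ (s * proj₁ e₁ + k * proj₁ e₂ , s * proj₂ e₁ + k * proj₂ e₂)
unimodular-coordinates (p₁ , p₂) (q₁ , q₂) det≡1 (β₁ , β₂) =
  β₁ * q₂ - β₂ * q₁ , p₁ * β₂ - p₂ * β₁ ,
  cong₂ _,_ (trans (sym (ℤP.*-identityʳ β₁)) (trans (cong (β₁ *_) (sym det≡1)) (first p₁ p₂ q₁ q₂ β₁ β₂)))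
            (trans (sym (ℤP.*-identityʳ β₂)) (trans (cong (β₂ *_) (sym det≡1)) (second p₁ p₂ q₁ q₂ β₁ β₂)))
  where
  first : ∀ p₁ p₂ q₁ q₂ β₁ β₂ → β₁ * (p₁ * q₂ - p₂ * q₁) ≡ (β₁ * q₂ - β₂ * q₁) * p₁ + (p₁ * β₂ - p₂ * β₁) * q₁
  first = solve-∀
  second : ∀ p₁ p₂ q₁ q₂ β₁ β₂ → β₂ * (p₁ * q₂ - p₂ * q₁) ≡ (β₁ * q₂ - β₂ * q₁) * p₂ + (p₁ * β₂ - p₂ * β₁) * q₂
  second = solve-∀

-- ω² = c₀ + c₁ω, and conj is the Galois conjugation ω ↦ c₁ − ω.
module QuadraticOrder (c₀ c₁ : ℤ) where

  infixl 7 _·_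
  _·_ : OK → OK → OK
  (x₁ , y₁) · (x₂ , y₂) = (x₁ * x₂ + y₁ * y₂ * c₀ , x₁ * y₂ + x₂ * y₁ + y₁ * y₂ * c₁)

  norm : OK → ℤ
  norm (x , y) = x * x + c₁ * x * y - c₀ * y * y

  neg : OK → OK
  neg (x , y) = (- x , - y)

  conj : OK → OK
  conj (x , y) = (x + c₁ * y , - y)

  scale : ℤ → OK → OK
  scale k (x , y) = (k * x , k * y)

  ·-identityʳ : ∀ v → v · (+ 1 , + 0) ≡ v
  ·-identityʳ (x , y) = cong₂ _,_ (first c₀ x y) (second c₁ x y)
    where
    first : ∀ c₀ x y → x * + 1 + y * + 0 * c₀ ≡ x
    first = solve-∀
    second : ∀ c₁ x y → x * + 0 + + 1 * y + y * + 0 * c₁ ≡ y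
    second = solve-∀

  ·-minus-oneʳ : ∀ v → v · (-[1+ 0 ] , + 0) ≡ neg v
  ·-minus-oneʳ (x , y) = cong₂ _,_ (first c₀ x y) (second c₁ x y)
    where
    first : ∀ c₀ x y → x * -[1+ 0 ] + y * + 0 * c₀ ≡ - x
    first = solve-∀
    second : ∀ c₁ x y → x * + 0 + -[1+ 0 ] * y + y * + 0 * c₁ ≡ - y
    second = solve-∀

  neg-·-swap : ∀ α β → neg α · β ≡ α · neg β
  neg-·-swap (a₁ , a₂) (b₁ , b₂) = cong₂ _,_ (first c₀ a₁ a₂ b₁ b₂) (second c₁ a₁ a₂ b₁ b₂)
    where
    first : ∀ c₀ a₁ a₂ b₁ b₂ → (- a₁) * b₁ + (- a₂) * b₂ * c₀ ≡ a₁ * (- b₁) + a₂ * (- b₂) * c₀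
    first = solve-∀
    second : ∀ c₁ a₁ a₂ b₁ b₂ → (- a₁) * b₂ + b₁ * (- a₂) + (- a₂) * b₂ * c₁ ≡ a₁ * (- b₂) + (- b₁) * a₂ + a₂ * (- b₂) * c₁
    second = solve-∀

  ·-rotate : ∀ r α β → r · (α · β) ≡ α · (r · β)
  ·-rotate (r₁ , r₂) (a₁ , a₂) (b₁ , b₂) =
    cong₂ _,_ (first c₀ c₁ r₁ r₂ a₁ a₂ b₁ b₂) (second c₀ c₁ r₁ r₂ a₁ a₂ b₁ b₂)
    where
    first : ∀ c₀ c₁ r₁ r₂ a₁ a₂ b₁ b₂ →
      r₁ * (a₁ * b₁ + a₂ * b₂ * c₀) + r₂ * (a₁ * b₂ + b₁ * a₂ + a₂ * b₂ * c₁) * c₀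
      ≡ a₁ * (r₁ * b₁ + r₂ * b₂ * c₀) + a₂ * (r₁ * b₂ + b₁ * r₂ + r₂ * b₂ * c₁) * c₀
    first = solve-∀
    second : ∀ c₀ c₁ r₁ r₂ a₁ a₂ b₁ b₂ →
      r₁ * (a₁ * b₂ + b₁ * a₂ + a₂ * b₂ * c₁) + (a₁ * b₁ + a₂ * b₂ * c₀) * r₂
        + r₂ * (a₁ * b₂ + b₁ * a₂ + a₂ * b₂ * c₁) * c₁
      ≡ a₁ * (r₁ * b₂ + b₁ * r₂ + r₂ * b₂ * c₁) + (r₁ * b₁ + r₂ * b₂ * c₀) * a₂
        + a₂ * (r₁ * b₂ + b₁ * r₂ + r₂ * b₂ * c₁) * c₁
    second = solve-∀

  neg-involutive : ∀ v → neg (neg v) ≡ v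
  neg-involutive (x , y) = cong₂ _,_ (ℤP.neg-involutive x) (ℤP.neg-involutive y)

  infix 4 _±≡_
  _±≡_ : OK → OK → Set
  v ±≡ α = v ≡ α ⊎ v ≡ neg α

  ±-sym : ∀ {u v} → u ±≡ v → v ±≡ u
  ±-sym (inj₁ refl) = inj₁ refl
  ±-sym {v = v} (inj₂ refl) = inj₂ (sym (neg-involutive v))

  ±-trans : ∀ {u v w} → u ±≡ v → v ±≡ w → u ±≡ w
  ±-trans (inj₁ refl) q = q
  ±-trans (inj₂ refl) (inj₁ refl) = inj₂ refl
  ±-trans (inj₂ refl) (inj₂ refl) = inj₁ (neg-involutive _)

  conj-involutive : ∀ v → conj (conj v) ≡ v
  conj-involutive (x , y) = cong₂ _,_ (first c₁ x y) (ℤP.neg-involutive y)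
    where
    first : ∀ c₁ x y → x + c₁ * y + c₁ * (- y) ≡ x
    first = solve-∀

  conj-injective : ∀ {v w} → conj v ≡ conj w → v ≡ w
  conj-injective {v} {w} e =
    trans (sym (conj-involutive v)) (trans (cong conj e) (conj-involutive w))

  ·-combination : ∀ α e₁ e₂ s k →
    α · (s * proj₁ e₁ + k * proj₁ e₂ , s * proj₂ e₁ + k * proj₂ e₂)
    ≡ (s * proj₁ (α · e₁) + k * proj₁ (α · e₂) , s * proj₂ (α · e₁) + k * proj₂ (α · e₂))
  ·-combination (x , y) (p₁ , p₂) (q₁ , q₂) s k = cong₂ _,_ (first c₀ x y s k p₁ p₂ q₁ q₂) (second c₁ x y s k p₁ p₂ q₁ q₂)
    where
    first : ∀ c₀ x y s k p₁ p₂ q₁ q₂ →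
      x * (s * p₁ + k * q₁) + y * (s * p₂ + k * q₂) * c₀ ≡ s * (x * p₁ + y * p₂ * c₀) + k * (x * q₁ + y * q₂ * c₀)
    first = solve-∀
    second : ∀ c₁ x y s k p₁ p₂ q₁ q₂ →
      x * (s * p₂ + k * q₂) + (s * p₁ + k * q₁) * y + y * (s * p₂ + k * q₂) * c₁
      ≡ s * (x * p₂ + p₁ * y + y * p₂ * c₁) + k * (x * q₂ + q₁ * y + y * q₂ * c₁)
    second = solve-∀

  norm-· : ∀ α β → norm (α · β) ≡ norm α * norm β
  norm-· (x₁ , y₁) (x₂ , y₂) = multiplicative c₀ c₁ x₁ y₁ x₂ y₂
    where
    multiplicative : ∀ c₀ c₁ x₁ y₁ x₂ y₂ →
      let x = x₁ * x₂ + y₁ * y₂ * c₀ ; y = x₁ * y₂ + x₂ * y₁ + y₁ * y₂ * c₁ in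
      x * x + c₁ * x * y - c₀ * y * y
      ≡ (x₁ * x₁ + c₁ * x₁ * y₁ - c₀ * y₁ * y₁) * (x₂ * x₂ + c₁ * x₂ * y₂ - c₀ * y₂ * y₂)
    multiplicative = solve-∀

  norm-neg : ∀ v → norm (neg v) ≡ norm v
  norm-neg (x , y) = even c₀ c₁ x y
    where
    even : ∀ c₀ c₁ x y → (- x) * (- x) + c₁ * (- x) * (- y) - c₀ * (- y) * (- y)
                       ≡ x * x + c₁ * x * y - c₀ * y * y
    even = solve-∀

  norm-conj : ∀ v → norm (conj v) ≡ norm v
  norm-conj (x , y) = invariant c₀ c₁ x y
    where
    invariant : ∀ c₀ c₁ x y → let X = x + c₁ * y ; Y = - y in
      X * X + c₁ * X * Y - c₀ * Y * Y ≡ x * x + c₁ * x * y - c₀ * y * y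
    invariant = solve-∀

  scale-·ˡ : ∀ k α β → scale k α · β ≡ scale k (α · β)
  scale-·ˡ k (g₁ , g₂) (p₁ , p₂) = cong₂ _,_ (first c₀ k g₁ g₂ p₁ p₂) (second c₁ k g₁ g₂ p₁ p₂)
    where
    first : ∀ c₀ k g₁ g₂ p₁ p₂ → (k * g₁) * p₁ + (k * g₂) * p₂ * c₀ ≡ k * (g₁ * p₁ + g₂ * p₂ * c₀)
    first = solve-∀
    second : ∀ c₁ k g₁ g₂ p₁ p₂ →
      (k * g₁) * p₂ + p₁ * (k * g₂) + (k * g₂) * p₂ * c₁ ≡ k * (g₁ * p₂ + p₁ * g₂ + g₂ * p₂ * c₁)
    second = solve-∀

  norm-scale : ∀ k v → norm (scale k v) ≡ k * (k * norm v)
  norm-scale k (x , y) = quadratic c₀ c₁ k x y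
    where
    quadratic : ∀ c₀ c₁ k x y → (k * x) * (k * x) + c₁ * (k * x) * (k * y) - c₀ * (k * y) * (k * y)
                              ≡ k * (k * (x * x + c₁ * x * y - c₀ * y * y))
    quadratic = solve-∀

-- Lattices in Hermite normal form

HNF : ℕ × ℕ × ℕ → Set
HNF (a , b , c) = (1 ℕ.≤ a) × (1 ℕ.≤ c) × (b ℕ.< a)

InL-a : ∀ a b c → InL a b c (+ a , + 0)
InL-a a b c = + 1 , + 0 , first (+ a) (+ b) , sym (ℤP.*-zeroˡ (+ c))
  where
  first : ∀ A B → A ≡ + 1 * A + + 0 * B
  first = solve-∀

InL-b+cω : ∀ a b c → InL a b c (+ b , + c)
InL-b+cω a b c = + 0 , + 1 , first (+ a) (+ b) , sym (ℤP.*-identityˡ (+ c))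
  where
  first : ∀ A B → B ≡ + 0 * A + + 1 * B
  first = solve-∀

InL⇒c∣ω-coordinate : ∀ {a b c x n} → InL a b c (x , + n) → c ∣ℕ n
InL⇒c∣ω-coordinate (_ , k , _ , n≡) = ∣⇒∣ᵤ (divides k n≡)

InL⇒a∣integer : ∀ {a b c n} → 1 ℕ.≤ c → InL a b c (+ n , + 0) → a ∣ℕ n
InL⇒a∣integer {a} {b} {suc c} _ (m , k , n≡ , 0≡) =
  ∣⇒∣ᵤ (divides m (trans n≡ (trans (cong (λ j → m * + a + j * + b) k≡0) (ℤP.+-identityʳ (m * + a)))))
  where
  k≡0 : k ≡ + 0
  k≡0 = ℤP.*-cancelʳ-≡ k (+ 0) (+ suc c) (sym 0≡)

residue-unique : ∀ {a b b′} m → b ℕ.< a → b′ ℕ.< a → + b ≡ m * + a + + 1 * + b′ → b ≡ b′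
residue-unique {a} {b} {b′} (+ zero) _ _ b≡ = ℤP.+-injective (trans b≡ (drop (+ a) (+ b′)))
  where
  drop : ∀ A B → + 0 * A + + 1 * B ≡ B
  drop = solve-∀
residue-unique {a} {b} {b′} (+ suc j) b<a _ b≡ =
  ⊥-elim (ℕP.<⇒≱ b<a (ℕP.≤-trans (ℕP.m≤m+n a (j ℕ.* a)) (ℕP.≤-trans (ℕP.m≤m+n (suc j ℕ.* a) b′) (ℕP.≤-reflexive (sym b≡′)))))
  where
  b≡′ : b ≡ suc j ℕ.* a ℕ.+ b′
  b≡′ = ℤP.+-injective (trans b≡ (trans (cong₂ _+_ (sym (ℤP.pos-* (suc j) a)) (ℤP.*-identityˡ (+ b′)))
          (sym (ℤP.pos-+ (suc j ℕ.* a) b′))))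
residue-unique {a} {b} {b′} -[1+ j ] _ b′<a b≡ =
  ⊥-elim (ℕP.<⇒≱ b′<a (ℕP.≤-trans (ℕP.m≤m+n a (j ℕ.* a)) (ℕP.≤-trans (ℕP.m≤n+m (suc j ℕ.* a) b) (ℕP.≤-reflexive b+ja≡))))
  where
  move : ∀ b S A B → b ≡ (- S) * A + + 1 * B → b + S * A ≡ B
  move b S A B h = trans (cong (λ u → u + S * A) h) (cancel S A B)
    where
    cancel : ∀ S A B → (- S) * A + + 1 * B + S * A ≡ B
    cancel = solve-∀
  b+ja≡ : b ℕ.+ suc j ℕ.* a ≡ b′
  b+ja≡ = ℤP.+-injective (trans (ℤP.pos-+ b (suc j ℕ.* a))
            (trans (cong (λ w → + b + w) (ℤP.pos-* (suc j) a)) (move (+ b) (+ suc j) (+ a) (+ b′) b≡)))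

hnf-unique : ∀ {a b c a′ b′ c′} → HNF (a , b , c) → HNF (a′ , b′ , c′) →
  (∀ z → InL a b c z → InL a′ b′ c′ z) → (∀ z → InL a′ b′ c′ z → InL a b c z) → (a , b , c) ≡ (a′ , b′ , c′)
hnf-unique {a} {b} {c} {a′} {b′} {c′} (_ , 1≤c , b<a) (_ , _ , b′<a′) ⊆ ⊇
  with ∣ℕ-antisym (InL⇒c∣ω-coordinate (⊆ _ (InL-b+cω a b c))) (InL⇒c∣ω-coordinate (⊇ _ (InL-b+cω a′ b′ c′)))
... | refl with ∣ℕ-antisym (InL⇒a∣integer 1≤c (⊆ _ (InL-a a b c))) (InL⇒a∣integer 1≤c (⊇ _ (InL-a a′ b′ c)))
... | refl with 1≤c | ⊆ _ (InL-b+cω a b c)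
... | s≤s _ | m , k , b≡ , c≡ with ℤP.*-cancelʳ-≡ k (+ 1) (+ c) (trans (sym c≡) (sym (ℤP.*-identityˡ (+ c))))
... | refl = cong (λ t → (a , t , c)) (residue-unique m b<a b′<a′ b≡)

module Lattices (c₀ c₁ : ℤ) where

  open QuadraticOrder c₀ c₁

  Generates : ℕ × ℕ × ℕ → OK → Set
  Generates (a , b , c) α =
    (z : OK) → (InL a b c z → Σ OK λ β → z ≡ α · β) × (Σ OK (λ β → z ≡ α · β) → InL a b c z)

  generated-closed : ∀ {a b c α} → Generates (a , b , c) α →
                     ∀ r z → InL a b c z → InL a b c (r · z)
  generated-closed {α = α} gen r z z∈ with proj₁ (gen z) z∈
  ... | β , refl = proj₂ (gen (r · (α · β))) (r · β , ·-rotate r α β)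

  ±-associates-generate : ∀ {a b c a′ b′ c′ α β} → Generates (a , b , c) α → Generates (a′ , b′ , c′) β →
    α ±≡ β → ∀ z → InL a b c z → InL a′ b′ c′ z
  ±-associates-generate {α = α} {β} α-gen β-gen α±≡β z z∈ with proj₁ (α-gen z) z∈ | α±≡β
  ... | γ , z≡αγ | inj₁ refl = proj₂ (β-gen z) (γ , z≡αγ)
  ... | γ , z≡αγ | inj₂ refl = proj₂ (β-gen z) (neg γ , trans z≡αγ (neg-·-swap β γ))

  -- (u , w) lies in the lattice aℤ + (b + ω)ℤ
  InJ : ℤ → ℤ → OK → Set
  InJ a b (u , w) = a ∣ u - b * w

  J-closed : ∀ a b → a ∣ norm (b , + 1) → ∀ v p → InJ a b v → InJ a b (v · p)
  J-closed a b (divides q hq) (u , w) (p₁ , p₂) (divides s hs) =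
    divides (s * p₁ - p₂ * w * q - p₂ * b * s)
      (trans (expand c₀ c₁ b u w p₁ p₂)
        (trans (cong₂ (λ F E → E * p₁ - p₂ * (w * F + b * E)) hq hs) (collect s a p₁ p₂ w q b)))
    where
    expand : ∀ c₀ c₁ b u w p₁ p₂ →
      (u * p₁ + w * p₂ * c₀) - b * (u * p₂ + p₁ * w + w * p₂ * c₁)
      ≡ (u - b * w) * p₁ - p₂ * (w * (b * b + c₁ * b * + 1 - c₀ * + 1 * + 1) + b * (u - b * w))
    expand = solve-∀
    collect : ∀ s a p₁ p₂ w q b →
      s * a * p₁ - p₂ * (w * (q * a) + b * (s * a)) ≡ (s * p₁ - p₂ * w * q - p₂ * b * s) * a
    collect = solve-∀

  J-multiples : ∀ a .{{_ : ℕ.NonZero a}} b → + a ∣ norm (b , + 1) →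
    ∀ γ → InJ (+ a) b γ → norm γ ≡ + a → ∀ v → InJ (+ a) b v → Σ OK λ β → v ≡ γ · β
  J-multiples a b (divides q hq) (g₁ , g₂) (divides s₂ hs₂) hN (u , w) (divides s hs) =
    (β₁ , β₂) , cong₂ _,_ (sym (ℤP.*-cancelˡ-≡ A _ _ (proj₁ scaled))) (sym (ℤP.*-cancelˡ-≡ A _ _ (proj₂ scaled)))
    where
    A β₁ β₂ : ℤ
    A = + a
    β₁ = s * s₂ * A + s * b * g₂ + b * w * s₂ + c₁ * s * g₂ + q * w * g₂
    β₂ = w * s₂ - s * g₂
    c₀-solved : c₀ ≡ b * b + c₁ * b - q * A
    c₀-solved = trans (split c₀ c₁ b) (cong (λ F → b * b + c₁ * b - F) hq)
      where
      split : ∀ c₀ c₁ b → c₀ ≡ b * b + c₁ * b - (b * b + c₁ * b * + 1 - c₀ * + 1 * + 1)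
      split = solve-∀
    -- β = conj γ · v / a, so that γβ = N(γ) v / a = v; the divisibility by a uses the
    -- value of c₀ forced by a ∣ N(b + ω).
    core : ∀ c₀ u g₁ → c₀ ≡ b * b + c₁ * b - q * A → u ≡ s * A + b * w → g₁ ≡ s₂ * A + b * g₂ →
           g₁ * g₁ + c₁ * g₁ * g₂ - c₀ * g₂ * g₂ ≡ A →
           (A * (g₁ * β₁ + g₂ * β₂ * c₀) ≡ A * u) × (A * (g₁ * β₂ + β₁ * g₂ + g₂ * β₂ * c₁) ≡ A * w)
    core ._ ._ ._ refl refl refl hN =
      trans (first c₁ A b q s s₂ w g₂) (trans (cong ((s * A + b * w) *_) hN) (ℤP.*-comm _ A)) ,
      trans (second c₁ A b q s s₂ w g₂) (trans (cong (w *_) hN) (ℤP.*-comm w A))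
      where
      first : ∀ c₁ A b q s s₂ w g₂ →
        let c₀ = b * b + c₁ * b - q * A ; u = s * A + b * w ; g₁ = s₂ * A + b * g₂
            β₁ = s * s₂ * A + s * b * g₂ + b * w * s₂ + c₁ * s * g₂ + q * w * g₂
            β₂ = w * s₂ - s * g₂ in
        A * (g₁ * β₁ + g₂ * β₂ * c₀) ≡ u * (g₁ * g₁ + c₁ * g₁ * g₂ - c₀ * g₂ * g₂)
      first = solve-∀
      second : ∀ c₁ A b q s s₂ w g₂ →
        let c₀ = b * b + c₁ * b - q * A ; g₁ = s₂ * A + b * g₂
            β₁ = s * s₂ * A + s * b * g₂ + b * w * s₂ + c₁ * s * g₂ + q * w * g₂
            β₂ = w * s₂ - s * g₂ in
        A * (g₁ * β₂ + β₁ * g₂ + g₂ * β₂ * c₁) ≡ w * (g₁ * g₁ + c₁ * g₁ * g₂ - c₀ * g₂ * g₂)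
      second = solve-∀
    scaled : (A * proj₁ ((g₁ , g₂) · (β₁ , β₂)) ≡ A * u) × (A * proj₂ ((g₁ , g₂) · (β₁ , β₂)) ≡ A * w)
    scaled = core c₀ u g₁ c₀-solved (i-j≡k⇒i≡k+j hs) (i-j≡k⇒i≡k+j hs₂) hN

  Generator : ℕ → ℤ → Set
  Generator a b = Σ OK λ γ → InJ (+ a) b γ × norm γ ≡ + a

  -- If N(b + ω) = a a₁ and γ₁ generates a₁ℤ + (b + ω)ℤ, then (b + ω) conj γ₁ / a₁ generates aℤ + (b + ω)ℤ.
  generator-descent : ∀ a a₁ .{{_ : ℕ.NonZero a₁}} b → norm (b , + 1) ≡ + a * + a₁ →
                      Generator a₁ b → Generator a b
  generator-descent a a₁ b hf ((x , y) , divides q₂ hq , hN) =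
    (g₁ , q₂) , divides y (in-J b q₂ A y) , ℤP.*-cancelˡ-≡ A₁ _ _ (ℤP.*-cancelˡ-≡ A₁ _ _ scaled)
    where
    A A₁ g₁ W : ℤ
    A = + a
    A₁ = + a₁
    g₁ = b * q₂ + A * y
    W = A₁ * b * q₂ + y * (b * b + c₁ * b * + 1 - c₀ * + 1 * + 1)
    in-J : ∀ b q₂ A y → (b * q₂ + A * y) - b * q₂ ≡ y * A
    in-J = solve-∀
    A₁g₁≡W : A₁ * g₁ ≡ W
    A₁g₁≡W = trans (distribute A₁ b q₂ A y) (cong (λ u → A₁ * b * q₂ + y * u) (sym hf))
      where
      distribute : ∀ A₁ b q₂ A y → A₁ * (b * q₂ + A * y) ≡ A₁ * b * q₂ + y * (A * A₁)
      distribute = solve-∀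
    scaled : A₁ * (A₁ * norm (g₁ , q₂)) ≡ A₁ * (A₁ * A)
    scaled = begin
      A₁ * (A₁ * norm (g₁ , q₂))                 ≡⟨ sym (norm-scale A₁ (g₁ , q₂)) ⟩
      norm (A₁ * g₁ , A₁ * q₂)                   ≡⟨ cong (λ u → norm (u , A₁ * q₂)) A₁g₁≡W ⟩
      norm (W , A₁ * q₂)                         ≡⟨ factor c₀ c₁ b q₂ A₁ y ⟩
      norm (b , + 1) * norm (q₂ * A₁ + b * y , y) ≡⟨ cong (λ u → norm (b , + 1) * norm (u , y)) (sym (i-j≡k⇒i≡k+j {x} {b * y} hq)) ⟩
      norm (b , + 1) * norm (x , y)              ≡⟨ cong₂ _*_ hf hN ⟩
      (A * A₁) * A₁                              ≡⟨ reorder A A₁ ⟩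
      A₁ * (A₁ * A)                              ∎
      where
      open ≡-Reasoning
      factor : ∀ c₀ c₁ b q₂ A₁ y →
        let W = A₁ * b * q₂ + y * (b * b + c₁ * b * + 1 - c₀ * + 1 * + 1) ; X = q₂ * A₁ + b * y in
        W * W + c₁ * W * (A₁ * q₂) - c₀ * (A₁ * q₂) * (A₁ * q₂)
        ≡ (b * b + c₁ * b * + 1 - c₀ * + 1 * + 1) * (X * X + c₁ * X * y - c₀ * y * y)
      factor = solve-∀
      reorder : ∀ A A₁ → (A * A₁) * A₁ ≡ A₁ * (A₁ * A)
      reorder = solve-∀

  -- The lattice with HNF (a₀c, b₀c, c) is c · (a₀ℤ + (b₀ + ω)ℤ).
  scaled-generator : ∀ a b c a₀ .{{_ : ℕ.NonZero a₀}} b₀ → a ≡ a₀ ℕ.* c → b ≡ b₀ ℕ.* c →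
    + a₀ ∣ norm (+ b₀ , + 1) → ((γ , _) : Generator a₀ (+ b₀)) →
    Generates (a , b , c) (scale (+ c) γ) × norm (scale (+ c) γ) ≡ + (a ℕ.* c)
  scaled-generator a b c a₀ b₀ a≡ b≡ a₀∣f (γ , γ∈J , Nγ≡a₀) = generates , norm≡
    where
    C : ℤ
    C = + c
    A≡ : + a ≡ + a₀ * C
    A≡ = trans (cong +_ a≡) (ℤP.pos-* a₀ c)
    B≡ : + b ≡ + b₀ * C
    B≡ = trans (cong +_ b≡) (ℤP.pos-* b₀ c)
    in-J : ∀ m a₀ k b₀ → (m * a₀ + k * b₀) - b₀ * k ≡ m * a₀
    in-J = solve-∀
    generates : Generates (a , b , c) (scale C γ)
    generates (z₁ , z₂) = into , from
      where
      into : InL a b c (z₁ , z₂) → Σ OK λ β → (z₁ , z₂) ≡ scale C γ · β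
      into (m , k , refl , refl) = multiple (J-multiples a₀ (+ b₀) a₀∣f γ γ∈J Nγ≡a₀
                                                (m * + a₀ + k * + b₀ , k) (divides m (in-J m (+ a₀) k (+ b₀))))
        where
        first : m * + a + k * + b ≡ C * (m * + a₀ + k * + b₀)
        first = trans (cong₂ (λ u v → m * u + k * v) A≡ B≡) (factor m (+ a₀) C k (+ b₀))
          where
          factor : ∀ m a₀ C k b₀ → m * (a₀ * C) + k * (b₀ * C) ≡ C * (m * a₀ + k * b₀)
          factor = solve-∀
        multiple : (Σ OK λ β → (m * + a₀ + k * + b₀ , k) ≡ γ · β) →
                   Σ OK λ β → (m * + a + k * + b , k * + c) ≡ scale C γ · β
        multiple (β , eβ) = β , trans (cong₂ _,_ first (ℤP.*-comm k C)) (trans (cong (scale C) eβ) (sym (scale-·ˡ C γ β)))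
      from : Σ OK (λ β → (z₁ , z₂) ≡ scale C γ · β) → InL a b c (z₁ , z₂)
      from (β , refl) = in-lattice (J-closed (+ a₀) (+ b₀) a₀∣f γ β γ∈J)
        where
        x y : ℤ
        x = proj₁ (γ · β)
        y = proj₂ (γ · β)
        scaled : scale C γ · β ≡ (C * x , C * y)
        scaled = scale-·ˡ C γ β
        in-lattice : InJ (+ a₀) (+ b₀) (γ · β) → InL a b c (scale C γ · β)
        in-lattice (divides s hs) = s , y , first , trans (cong proj₂ scaled) (ℤP.*-comm C y)
          where
          first : proj₁ (scale C γ · β) ≡ s * + a + y * + b
          first = trans (cong proj₁ scaled) (trans (cong (C *_) (i-j≡k⇒i≡k+j hs))
                    (trans (expand C s (+ a₀) (+ b₀) y) (sym (cong₂ (λ u v → s * u + y * v) A≡ B≡))))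
            where
            expand : ∀ C s a₀ b₀ y → C * (s * a₀ + b₀ * y) ≡ s * (a₀ * C) + y * (b₀ * C)
            expand = solve-∀
    norm≡ : norm (scale C γ) ≡ + (a ℕ.* c)
    norm≡ = trans (norm-scale C γ) (trans (cong (λ t → C * (C * t)) Nγ≡a₀)
              (trans (reorder C (+ a₀)) (sym (trans (ℤP.pos-* a c) (cong (_* C) A≡)))))
      where
      reorder : ∀ C N → C * (C * N) ≡ N * C * C
      reorder = solve-∀

  generated-by-basis : ∀ {α e₁ e₂} a b g t → det e₁ e₂ ≡ + 1 →
    α · e₁ ≡ (+ a , + 0) → α · e₂ ≡ (+ b + t * + a , + g) → Generates (a , b , g) α
  generated-by-basis {α} {e₁} {e₂} a b g t det≡1 αe₁≡ αe₂≡ z = into , from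
    where
    image : ∀ s k → α · (s * proj₁ e₁ + k * proj₁ e₂ , s * proj₂ e₁ + k * proj₂ e₂)
                    ≡ ((s + k * t) * + a + k * + b , k * + g)
    image s k = trans (·-combination α e₁ e₂ s k)
      (trans (cong₂ (λ u v → (s * proj₁ u + k * proj₁ v , s * proj₂ u + k * proj₂ v)) αe₁≡ αe₂≡)
        (cong₂ _,_ (first s k t (+ a) (+ b)) (second s k (+ g))))
      where
      first : ∀ s k t A B → s * A + k * (B + t * A) ≡ (s + k * t) * A + k * B
      first = solve-∀
      second : ∀ s k G → s * + 0 + k * G ≡ k * G
      second = solve-∀
    into : InL a b g z → Σ OK λ β → z ≡ α · β
    into (m , k , refl , refl) =
      _ , sym (trans (image (m - k * t) k) (cong (λ u → (u * + a + k * + b , k * + g)) (cancel m (k * t))))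
      where
      cancel : ∀ m j → m - j + j ≡ m
      cancel = solve-∀
    from : Σ OK (λ β → z ≡ α · β) → InL a b g z
    from (β , refl) = in-lattice (unimodular-coordinates e₁ e₂ det≡1 β)
      where
      in-lattice : (Σ ℤ λ s → Σ ℤ λ k → β ≡ (s * proj₁ e₁ + k * proj₁ e₂ , s * proj₂ e₁ + k * proj₂ e₂)) →
                   InL a b g (α · β)
      in-lattice (s , k , β≡) = s + k * t , k , cong proj₁ αβ≡ , cong proj₂ αβ≡
        where
        αβ≡ : α · β ≡ ((s + k * t) * + a + k * + b , k * + g)
        αβ≡ = trans (cong (α ·_) β≡) (image s k)

  Principal-HNF : OK → ℕ → Set
  Principal-HNF α n = Σ (ℕ × ℕ × ℕ) λ I → Generates I α × HNF I × normI I ≡ n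

  -- The basis e₁ = Zp − Ypω, e₂ = P + Qω of ℤ[ω] has determinant 1 and α maps it to
  -- (N(α)/g, 0) and (E, g); reducing E modulo N(α)/g gives the HNF.
  principal-hnf-from-bézout : ∀ x y n g P Q Yp Zp → norm (x , y) ≡ + suc n →
    + suc g ≡ P * y + Q * (x + c₁ * y) → y ≡ Yp * + suc g → x + c₁ * y ≡ Zp * + suc g →
    Principal-HNF (x , y) (suc n)
  principal-hnf-from-bézout x y n g P Q Yp Zp N≡ g≡ y≡ z≡ = from-first (proj₁ (α · e₁)) refl
    where
    α : OK
    α = (x , y)
    G : ℤ
    G = + suc g
    e₁ e₂ : OK
    e₁ = (Zp , - Yp)
    e₂ = (P , Q)
    det≡1 : det e₁ e₂ ≡ + 1
    det≡1 = ℤP.*-cancelˡ-≡ G _ _ (begin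
      G * (Zp * Q - (- Yp) * P)     ≡⟨ expand G Zp Q Yp P ⟩
      P * (Yp * G) + Q * (Zp * G)   ≡⟨ cong₂ (λ u v → P * u + Q * v) (sym y≡) (sym z≡) ⟩
      P * y + Q * (x + c₁ * y)      ≡⟨ sym g≡ ⟩
      G                             ≡⟨ sym (ℤP.*-identityʳ G) ⟩
      G * + 1                       ∎)
      where
      open ≡-Reasoning
      expand : ∀ G Zp Q Yp P → G * (Zp * Q - (- Yp) * P) ≡ P * (Yp * G) + Q * (Zp * G)
      expand = solve-∀
    αe₁-scaled : (G * proj₁ (α · e₁) ≡ norm α) × (proj₂ (α · e₁) ≡ + 0)
    αe₁-scaled = core x y (trans (i+j≡k⇒i≡k-j z≡) (cong (λ w → Zp * G - c₁ * w) y≡)) y≡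
      where
      core : ∀ x y → x ≡ Zp * G - c₁ * (Yp * G) → y ≡ Yp * G →
        (G * (x * Zp + y * (- Yp) * c₀) ≡ x * x + c₁ * x * y - c₀ * y * y) × (x * (- Yp) + Zp * y + y * (- Yp) * c₁ ≡ + 0)
      core ._ ._ refl refl = first c₀ c₁ Yp Zp G , second c₁ Yp Zp G
        where
        first : ∀ c₀ c₁ Yp Zp G → let y = Yp * G ; x = Zp * G - c₁ * (Yp * G) in
          G * (x * Zp + y * (- Yp) * c₀) ≡ x * x + c₁ * x * y - c₀ * y * y
        first = solve-∀
        second : ∀ c₁ Yp Zp G → let y = Yp * G ; x = Zp * G - c₁ * (Yp * G) in
          x * (- Yp) + Zp * y + y * (- Yp) * c₁ ≡ + 0
        second = solve-∀
    from-first : ∀ F → proj₁ (α · e₁) ≡ F → Principal-HNF α (suc n)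
    from-first (+ 0) F≡ = ⊥-elim (ℕP.0≢1+n (ℤP.+-injective
      (trans (sym (ℤP.*-zeroʳ G)) (trans (cong (G *_) (sym F≡)) (trans (proj₁ αe₁-scaled) N≡)))))
    from-first -[1+ m ] F≡ with trans (cong (G *_) (sym F≡)) (trans (proj₁ αe₁-scaled) N≡)
    ... | ()
    from-first (+ a@(suc _)) F≡ = (a , b , suc g) , generates , (s≤s z≤n , s≤s z≤n , n%ℕd<d E a) , norm≡
      where
      E t : ℤ
      E = proj₁ (α · e₂)
      t = E /ℕ a
      b : ℕ
      b = E %ℕ a
      generates : Generates (a , b , suc g) α
      generates = generated-by-basis {α} {e₁} {e₂} a b (suc g) t det≡1 (cong₂ _,_ F≡ (proj₂ αe₁-scaled))
        (cong₂ _,_ (a≡a%ℕn+[a/ℕn]*n E a) (trans (second-coordinate c₁ x y P Q) (sym g≡)))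
        where
        second-coordinate : ∀ c₁ x y P Q → x * Q + P * y + y * Q * c₁ ≡ P * y + Q * (x + c₁ * y)
        second-coordinate = solve-∀
      norm≡ : a ℕ.* suc g ≡ suc n
      norm≡ = ℤP.+-injective (begin
        + (a ℕ.* suc g)        ≡⟨ ℤP.pos-* a (suc g) ⟩
        + a * G                ≡⟨ ℤP.*-comm (+ a) G ⟩
        G * + a                ≡⟨ cong (G *_) (sym F≡) ⟩
        G * proj₁ (α · e₁)     ≡⟨ proj₁ αe₁-scaled ⟩
        norm α                 ≡⟨ N≡ ⟩
        + suc n                ∎)
        where open ≡-Reasoning

  principal-hnf : ∀ α n → norm α ≡ + suc n → Principal-HNF α (suc n)
  principal-hnf (x , y) n N≡ with bézout y (x + c₁ * y)
  ... | suc g , P , Q , g≡ , divides Yp y≡ , divides Zp z≡ = principal-hnf-from-bézout x y n g P Q Yp Zp N≡ g≡ y≡ z≡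
  ... | zero , _ , _ , _ , divides Yp y≡ , divides Zp z≡ =
    ⊥-elim (ℕP.0≢1+n (ℤP.+-injective (trans (sym (trans (in-terms-of-z c₀ c₁ x y)
      (trans (cong₂ (λ Z w → Z * Z - c₁ * w * Z - c₀ * w * w) z≡ y≡) (vanish c₀ c₁ Yp Zp)))) N≡)))
    where
    in-terms-of-z : ∀ c₀ c₁ x y → x * x + c₁ * x * y - c₀ * y * y
      ≡ (x + c₁ * y) * (x + c₁ * y) - c₁ * y * (x + c₁ * y) - c₀ * y * y
    in-terms-of-z = solve-∀
    vanish : ∀ c₀ c₁ Yp Zp → (Zp * + 0) * (Zp * + 0) - c₁ * (Yp * + 0) * (Zp * + 0) - c₀ * (Yp * + 0) * (Yp * + 0) ≡ + 0
    vanish = solve-∀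

  -- ω·a = aω and ω·(b + cω) = c c₀ + (b + c c₁)ω must lie in the lattice, which forces
  -- c ∣ a, c ∣ b and N(b/c + ω) ≡ 0 modulo a/c.
  ω-closed-hnf : ∀ {a b c} → 1 ℕ.≤ c → (∀ z → InL a b c z → InL a b c ((+ 0 , + 1) · z)) →
    Σ ℕ λ a₀ → Σ ℕ λ b₀ → (a ≡ a₀ ℕ.* c) × (b ≡ b₀ ℕ.* c) × (+ a₀ ∣ norm (+ b₀ , + 1))
  ω-closed-hnf {a} {b} {c@(suc _)} _ closed
    with closed _ (InL-a a b c) | closed _ (InL-b+cω a b c)
  ... | _ , k₁ , _ , A≡ | m₂ , k₂ , c₀C≡ , B+Cc₁≡ =
    ∣ k₁ ∣ , b₀ , a≡ , b≡ , divides (- m₂) f≡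
    where
    A B C : ℤ
    A = + a
    B = + b
    C = + c
    a≡ : a ≡ ∣ k₁ ∣ ℕ.* c
    a≡ = trans (cong ∣_∣ (trans (sym (simplify-a c₁ A)) A≡)) (ℤP.abs-* k₁ C)
      where
      simplify-a : ∀ c₁ A → + 0 * + 0 + A * + 1 + + 1 * + 0 * c₁ ≡ A
      simplify-a = solve-∀
    B≡ : B ≡ (k₂ - c₁) * C
    B≡ = trans (i+j≡k⇒i≡k-j (trans (sym (simplify-b c₁ B C)) B+Cc₁≡)) (factor k₂ C c₁)
      where
      simplify-b : ∀ c₁ B C → + 0 * C + B * + 1 + + 1 * C * c₁ ≡ B + C * c₁
      simplify-b = solve-∀
      factor : ∀ k₂ C c₁ → k₂ * C - C * c₁ ≡ (k₂ - c₁) * C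
      factor = solve-∀
    b₀ : ℕ
    b₀ = ∣ k₂ - c₁ ∣
    b≡ : b ≡ b₀ ℕ.* c
    b≡ = trans (cong ∣_∣ B≡) (ℤP.abs-* (k₂ - c₁) C)
    k₂≡ : k₂ ≡ + b₀ + c₁
    k₂≡ = trans (i-j≡k⇒i≡k+j {k₂} {c₁} refl) (cong (_+ c₁) (ℤP.*-cancelʳ-≡ (k₂ - c₁) (+ b₀) C
            (trans (sym B≡) (trans (cong +_ b≡) (ℤP.pos-* b₀ c)))))
    c₀≡ : c₀ ≡ m₂ * + ∣ k₁ ∣ + k₂ * + b₀
    c₀≡ = ℤP.*-cancelʳ-≡ c₀ _ C (trans (trans (sym (simplify-c₀ c₀ B C)) c₀C≡)
            (trans (cong₂ (λ u v → m₂ * u + k₂ * v) (trans (cong +_ a≡) (ℤP.pos-* ∣ k₁ ∣ c)) (trans (cong +_ b≡) (ℤP.pos-* b₀ c)))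
              (factor m₂ (+ ∣ k₁ ∣) C k₂ (+ b₀))))
      where
      simplify-c₀ : ∀ c₀ B C → + 0 * B + + 1 * C * c₀ ≡ c₀ * C
      simplify-c₀ = solve-∀
      factor : ∀ m₂ A₀ C k₂ B₀ → m₂ * (A₀ * C) + k₂ * (B₀ * C) ≡ (m₂ * A₀ + k₂ * B₀) * C
      factor = solve-∀
    f≡ : norm (+ b₀ , + 1) ≡ (- m₂) * + ∣ k₁ ∣
    f≡ = trans (cong (λ u → + b₀ * + b₀ + c₁ * + b₀ * + 1 - u * + 1 * + 1)
                  (trans c₀≡ (cong (λ k → m₂ * + ∣ k₁ ∣ + k * + b₀) k₂≡)))
           (collapse c₁ m₂ (+ ∣ k₁ ∣) (+ b₀))
      where
      collapse : ∀ c₁ m₂ A₀ B₀ → B₀ * B₀ + c₁ * B₀ * + 1 - (m₂ * A₀ + (B₀ + c₁) * B₀) * + 1 * + 1 ≡ (- m₂) * A₀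
      collapse = solve-∀

-- Positive definiteness of the norm form

module PositiveDefinite (c₀ c₁ : ℤ) (Δ : ℕ) (discriminant : - (+ 4 * c₀) - c₁ * c₁ ≡ + Δ) where

  open QuadraticOrder c₀ c₁
  open Lattices c₀ c₁

  four-norm : ∀ x y → + 4 * norm (x , y) ≡ + (∣ + 2 * x + c₁ * y ∣ ℕ.* ∣ + 2 * x + c₁ * y ∣ ℕ.+ Δ ℕ.* (∣ y ∣ ℕ.* ∣ y ∣))
  four-norm x y = begin
    + 4 * norm (x , y)                   ≡⟨ complete-square c₀ c₁ x y ⟩
    T * T + (- (+ 4 * c₀) - c₁ * c₁) * (y * y) ≡⟨ cong₂ (λ u v → u + v * (y * y)) (square-∣∣ T) discriminant ⟩
    + (∣ T ∣ ℕ.* ∣ T ∣) + + Δ * (y * y)    ≡⟨ cong (λ v → + (∣ T ∣ ℕ.* ∣ T ∣) + + Δ * v) (square-∣∣ y) ⟩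
    + (∣ T ∣ ℕ.* ∣ T ∣) + + Δ * + (∣ y ∣ ℕ.* ∣ y ∣)
      ≡⟨ cong (λ v → + (∣ T ∣ ℕ.* ∣ T ∣) + v) (sym (ℤP.pos-* Δ _)) ⟩
    + (∣ T ∣ ℕ.* ∣ T ∣) + + (Δ ℕ.* (∣ y ∣ ℕ.* ∣ y ∣))
      ≡⟨ sym (ℤP.pos-+ (∣ T ∣ ℕ.* ∣ T ∣) _) ⟩
    + (∣ T ∣ ℕ.* ∣ T ∣ ℕ.+ Δ ℕ.* (∣ y ∣ ℕ.* ∣ y ∣)) ∎
    where
    open ≡-Reasoning
    T : ℤ
    T = + 2 * x + c₁ * y
    complete-square : ∀ c₀ c₁ x y → + 4 * (x * x + c₁ * x * y - c₀ * y * y)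
      ≡ (+ 2 * x + c₁ * y) * (+ 2 * x + c₁ * y) + (- (+ 4 * c₀) - c₁ * c₁) * (y * y)
    complete-square = solve-∀

  norm-on-ℤ : ∀ x → norm (x , + 0) ≡ x * x
  norm-on-ℤ x = collapse c₀ c₁ x
    where
    collapse : ∀ c₀ c₁ x → x * x + c₁ * x * + 0 - c₀ * + 0 * + 0 ≡ x * x
    collapse = solve-∀

  norm≡0⇒≡0 : .{{_ : ℕ.NonZero Δ}} → ∀ v → norm v ≡ + 0 → v ≡ (+ 0 , + 0)
  norm≡0⇒≡0 (x , y) N≡0 = cong₂ _,_ x≡0 y≡0
    where
    squares≡0 : ∣ + 2 * x + c₁ * y ∣ ℕ.* ∣ + 2 * x + c₁ * y ∣ ℕ.+ Δ ℕ.* (∣ y ∣ ℕ.* ∣ y ∣) ≡ 0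
    squares≡0 = sym (ℤP.+-injective (trans (cong (+ 4 *_) (sym N≡0)) (four-norm x y)))
    y≡0 : y ≡ + 0
    y≡0 = ℤP.∣i∣≡0⇒i≡0 (m*m≡0⇒m≡0 ∣ y ∣ (ℕP.m*n≡0⇒m≡0 _ Δ
            (trans (ℕP.*-comm _ Δ) (ℕP.m+n≡0⇒n≡0 _ squares≡0))))
    x≡0 : x ≡ + 0
    x≡0 = ℤP.∣i∣≡0⇒i≡0 (m*m≡0⇒m≡0 ∣ x ∣ (trans (sym (ℤP.abs-* x x))
            (cong ∣_∣ (trans (sym (norm-on-ℤ x)) (trans (cong (λ t → norm (x , t)) (sym y≡0)) N≡0)))))

  module _ (5≤Δ : 5 ℕ.≤ Δ) where

    norm±1⇒±1 : ∀ β → ∣ norm β ∣ ≡ 1 → β ≡ (+ 1 , + 0) ⊎ β ≡ (-[1+ 0 ] , + 0)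
    norm±1⇒±1 (x , y) ∣N∣≡1 = conclude (∣i∣≡1⇒i≡±1 x ∣x∣≡1)
      where
      -- N = −1 is impossible, and N = 1 forces y = 0 because Δ > 4.
      squares≡4 : norm (x , y) ≡ + 1 ⊎ norm (x , y) ≡ -[1+ 0 ] →
                  ∣ + 2 * x + c₁ * y ∣ ℕ.* ∣ + 2 * x + c₁ * y ∣ ℕ.+ Δ ℕ.* (∣ y ∣ ℕ.* ∣ y ∣) ≡ 4
      squares≡4 (inj₁ N≡1)  = sym (ℤP.+-injective (trans (cong (+ 4 *_) (sym N≡1)) (four-norm x y)))
      squares≡4 (inj₂ N≡-1) = ⊥-elim (-4≢+ (trans (cong (+ 4 *_) (sym N≡-1)) (four-norm x y)))
        where
        -4≢+ : ∀ {n} → -[1+ 3 ] ≢ + n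
        -4≢+ ()
      Δs²-bound : ∀ s T → T ℕ.* T ℕ.+ Δ ℕ.* (s ℕ.* s) ≡ 4 → s ≡ 0
      Δs²-bound zero    T _  = refl
      Δs²-bound (suc s) T eq = ⊥-elim (ℕP.<-irrefl refl (ℕP.≤-trans 5≤Δ
        (ℕP.≤-trans (ℕP.m≤m*n Δ (suc s ℕ.* suc s)) (ℕP.≤-trans (ℕP.m≤n+m _ (T ℕ.* T)) (ℕP.≤-reflexive eq)))))
      y≡0 : y ≡ + 0
      y≡0 = ℤP.∣i∣≡0⇒i≡0 (Δs²-bound ∣ y ∣ ∣ + 2 * x + c₁ * y ∣ (squares≡4 (∣i∣≡1⇒i≡±1 _ ∣N∣≡1)))
      ∣x∣≡1 : ∣ x ∣ ≡ 1
      ∣x∣≡1 = ℕP.m*n≡1⇒m≡1 ∣ x ∣ ∣ x ∣ (trans (sym (ℤP.abs-* x x))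
                (trans (cong ∣_∣ (sym (trans (cong (λ t → norm (x , t)) y≡0) (norm-on-ℤ x)))) ∣N∣≡1))
      conclude : x ≡ + 1 ⊎ x ≡ -[1+ 0 ] → (x , y) ≡ (+ 1 , + 0) ⊎ (x , y) ≡ (-[1+ 0 ] , + 0)
      conclude (inj₁ x≡1)  = inj₁ (cong₂ _,_ x≡1 y≡0)
      conclude (inj₂ x≡-1) = inj₂ (cong₂ _,_ x≡-1 y≡0)

    generators-associate : ∀ {I α v n} → Generates I α → Generates I v → norm v ≡ + suc n →
                           v ±≡ α
    generators-associate {α = α} {v} {n} α-gen v-gen N≡ with proj₁ (α-gen v) (proj₂ (v-gen v) (_ , sym (·-identityʳ v)))
    ... | β , v≡αβ = ±1-multiple (norm±1⇒±1 β ∣Nβ∣≡1)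
      where
      α≡vβ′ : Σ OK λ β′ → α ≡ v · β′
      α≡vβ′ = proj₁ (v-gen α) (proj₂ (α-gen α) (_ , sym (·-identityʳ α)))
      β′ : OK
      β′ = proj₁ α≡vβ′
      Nv : ℤ
      Nv = norm v
      Nβ·Nβ′≡1 : norm β * norm β′ ≡ + 1
      Nβ·Nβ′≡1 = ℤP.*-cancelˡ-≡ (+ suc n) _ _ (subst (λ t → t * (norm β * norm β′) ≡ t * + 1) N≡ (begin
        Nv * (norm β * norm β′)        ≡⟨ rearrange Nv (norm β) (norm β′) ⟩
        (Nv * norm β′) * norm β        ≡⟨ cong (_* norm β) (sym (trans (cong norm (proj₂ α≡vβ′)) (norm-· v β′))) ⟩
        norm α * norm β                ≡⟨ sym (trans (cong norm v≡αβ) (norm-· α β)) ⟩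
        Nv                             ≡⟨ sym (ℤP.*-identityʳ Nv) ⟩
        Nv * + 1                       ∎))
        where
        open ≡-Reasoning
        rearrange : ∀ x y z → x * (y * z) ≡ (x * z) * y
        rearrange = solve-∀
      ∣Nβ∣≡1 : ∣ norm β ∣ ≡ 1
      ∣Nβ∣≡1 = ℕP.m*n≡1⇒m≡1 ∣ norm β ∣ ∣ norm β′ ∣ (trans (sym (ℤP.abs-* (norm β) (norm β′))) (cong ∣_∣ Nβ·Nβ′≡1))
      ±1-multiple : β ≡ (+ 1 , + 0) ⊎ β ≡ (-[1+ 0 ] , + 0) → v ±≡ α
      ±1-multiple (inj₁ refl) = inj₁ (trans v≡αβ (·-identityʳ α))
      ±1-multiple (inj₂ refl) = inj₂ (trans v≡αβ (·-minus-oneʳ α))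

-- Class number one by reduction of binary quadratic forms

-- A reduced form a X² + t XY + ((t² + Δ)/4a) Y² with a ≥ 2 would be a second class of
-- discriminant −Δ; excluding all of them says that the class number is one.
NoReducedFormAt : ℕ → ℕ → ℕ → Set
NoReducedFormAt Δ a t = 2 ℕ.≤ a → 3 ℕ.* (a ℕ.* a) ℕ.≤ Δ → t ℕ.≤ a → ¬ (4 ℕ.* a ∣ℕ t ℕ.* t ℕ.+ Δ)

NoReducedForm : ℕ → Set
NoReducedForm Δ = ∀ a t → NoReducedFormAt Δ a t

module ClassNumberOne (c₀ c₁ : ℤ) (c₁ℕ Δ : ℕ) (c₁≡ : c₁ ≡ + c₁ℕ) (c₁ℕ≤1 : c₁ℕ ℕ.≤ 1)
  (discriminant : - (+ 4 * c₀) - c₁ * c₁ ≡ + Δ) .{{_ : ℕ.NonZero Δ}} (no-reduced-form : NoReducedForm Δ) where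

  open QuadraticOrder c₀ c₁
  open Lattices c₀ c₁
  open PositiveDefinite c₀ c₁ Δ discriminant

  f : ℤ → ℤ
  f b = norm (b , + 1)

  T : ℤ → ℕ
  T b = ∣ + 2 * b + c₁ * + 1 ∣

  T-natural : ∀ r → + 2 * + r + c₁ * + 1 ≡ + (2 ℕ.* r ℕ.+ c₁ℕ)
  T-natural r = trans (cong₂ _+_ (sym (ℤP.pos-* 2 r)) (trans (cong (_* + 1) c₁≡) (ℤP.*-identityʳ (+ c₁ℕ))))
                  (sym (ℤP.pos-+ (2 ℕ.* r) c₁ℕ))

  f-shift : ∀ a b s → a ∣ f (b + s * a) → a ∣ f b
  f-shift a b s (divides q h) = divides (q - s * (+ 2 * b + s * a + c₁))
    (trans (expand c₀ c₁ b s a) (trans (cong (λ z → z - s * (+ 2 * b + s * a + c₁) * a) h) (factor q s _ a)))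
    where
    expand : ∀ c₀ c₁ b s a → b * b + c₁ * b * + 1 - c₀ * + 1 * + 1
      ≡ ((b + s * a) * (b + s * a) + c₁ * (b + s * a) * + 1 - c₀ * + 1 * + 1) - s * (+ 2 * b + s * a + c₁) * a
    expand = solve-∀
    factor : ∀ q s w a → q * a - s * w * a ≡ (q - s * w) * a
    factor = solve-∀

  J-shift : ∀ a b s γ → InJ a b γ → InJ a (b + s * a) γ
  J-shift a b s (g₁ , g₂) (divides q h) = divides (q - s * g₂)
    (trans (expand g₁ g₂ b s a) (trans (cong (λ z → z - s * g₂ * a) h) (factor q s g₂ a)))
    where
    expand : ∀ g₁ g₂ b s a → g₁ - (b + s * a) * g₂ ≡ (g₁ - b * g₂) - s * g₂ * a
    expand = solve-∀
    factor : ∀ q s w a → q * a - s * w * a ≡ (q - s * w) * a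
    factor = solve-∀

  reduced-representative : ∀ a .{{_ : ℕ.NonZero a}} b → Σ ℤ λ b₁ → Σ ℤ λ s → (b ≡ b₁ + s * + a) × (T b₁ ℕ.≤ a)
  reduced-representative a b with 2 ℕ.* (b %ℕ a) ℕ.+ c₁ℕ ℕ.≤? a
  ... | yes X≤a = + r , b /ℕ a , a≡a%ℕn+[a/ℕn]*n b a , subst (ℕ._≤ a) (sym T≡) X≤a
    where
    r : ℕ
    r = b %ℕ a
    T≡ : T (+ r) ≡ 2 ℕ.* r ℕ.+ c₁ℕ
    T≡ = cong ∣_∣ (T-natural r)
  ... | no X≰a = + r - + a , b /ℕ a + + 1 , trans (a≡a%ℕn+[a/ℕn]*n b a) (shift (+ r) (b /ℕ a) (+ a)) ,
                 subst (ℕ._≤ a) (sym T≡) (ℕP.m≤n+o⇒m∸n≤o (2 ℕ.* a) X 2a≤X+a)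
    where
    r X : ℕ
    r = b %ℕ a
    X = 2 ℕ.* r ℕ.+ c₁ℕ
    shift : ∀ r q A → r + q * A ≡ (r - A) + (q + + 1) * A
    shift = solve-∀
    X≤2a : X ℕ.≤ 2 ℕ.* a
    X≤2a = begin
      2 ℕ.* r ℕ.+ c₁ℕ      ≤⟨ ℕP.+-monoʳ-≤ (2 ℕ.* r) c₁ℕ≤1 ⟩
      2 ℕ.* r ℕ.+ 1        ≤⟨ ℕP.n≤1+n _ ⟩
      suc (2 ℕ.* r ℕ.+ 1)  ≡⟨ cong suc (ℕP.+-comm _ 1) ⟩
      2 ℕ.+ 2 ℕ.* r        ≡⟨ sym (ℕP.*-distribˡ-+ 2 1 r) ⟩
      2 ℕ.* suc r          ≤⟨ ℕP.*-monoʳ-≤ 2 (n%ℕd<d b a) ⟩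
      2 ℕ.* a              ∎
      where open ℕP.≤-Reasoning
    T≡ : T (+ r - + a) ≡ 2 ℕ.* a ℕ.∸ X
    T≡ = begin
      ∣ + 2 * (+ r - + a) + c₁ * + 1 ∣      ≡⟨ cong ∣_∣ (distribute (+ r) (+ a) c₁) ⟩
      ∣ (+ 2 * + r + c₁ * + 1) - + 2 * + a ∣ ≡⟨ cong₂ (λ u v → ∣ u - v ∣) (T-natural r) (sym (ℤP.pos-* 2 a)) ⟩
      ∣ + X - + (2 ℕ.* a) ∣                ≡⟨ cong ∣_∣ (ℤP.m-n≡m⊖n X (2 ℕ.* a)) ⟩
      ∣ X ℤ.⊖ (2 ℕ.* a) ∣                  ≡⟨ cong ∣_∣ (ℤP.⊖-≤ X≤2a) ⟩
      ∣ - + (2 ℕ.* a ℕ.∸ X) ∣              ≡⟨ ℤP.∣-i∣≡∣i∣ (+ (2 ℕ.* a ℕ.∸ X)) ⟩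
      2 ℕ.* a ℕ.∸ X                        ∎
      where
      open ≡-Reasoning
      distribute : ∀ r a c → + 2 * (r - a) + c * + 1 ≡ (+ 2 * r + c * + 1) - + 2 * a
      distribute = solve-∀
    2a≤X+a : 2 ℕ.* a ℕ.≤ X ℕ.+ a
    2a≤X+a = subst (ℕ._≤ X ℕ.+ a) (cong (a ℕ.+_) (sym (ℕP.+-identityʳ a)))
               (ℕP.+-monoˡ-≤ a (ℕP.<⇒≤ (ℕP.≰⇒> X≰a)))

  -- 4 a a₁ = T² + Δ; a₁ ≥ a would make (a, T, a₁) a reduced form.
  cofactor-below : ∀ a → 2 ℕ.≤ a → ∀ b → + a ∣ f b → T b ℕ.≤ a →
    Σ ℕ λ a₁ → (f b ≡ + a * + a₁) × (1 ℕ.≤ a₁) × (a₁ ℕ.< a)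
  cofactor-below a 2≤a@(s≤s (s≤s _)) b (divides q f≡) T≤a = from-quotient q f≡
    where
    four-f : + 4 * f b ≡ + (T b ℕ.* T b ℕ.+ Δ)
    four-f = trans (four-norm b (+ 1)) (cong (λ z → + (T b ℕ.* T b ℕ.+ z)) (ℕP.*-identityʳ Δ))
    from-quotient : ∀ q → f b ≡ q * + a → Σ ℕ λ a₁ → (f b ≡ + a * + a₁) × (1 ℕ.≤ a₁) × (a₁ ℕ.< a)
    from-quotient -[1+ m ] f≡ with trans (sym (cong (+ 4 *_) f≡)) four-f
    ... | ()
    from-quotient (+ a₁) f≡ = a₁ , trans f≡ (ℤP.*-comm (+ a₁) (+ a)) , 1≤a₁ a₁ four-a₁a , a₁<a
      where
      four-a₁a : 4 ℕ.* (a₁ ℕ.* a) ≡ T b ℕ.* T b ℕ.+ Δ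
      four-a₁a = ℤP.+-injective (begin
        + (4 ℕ.* (a₁ ℕ.* a))  ≡⟨ ℤP.pos-* 4 (a₁ ℕ.* a) ⟩
        + 4 * + (a₁ ℕ.* a)    ≡⟨ cong (+ 4 *_) (ℤP.pos-* a₁ a) ⟩
        + 4 * (+ a₁ * + a)    ≡⟨ cong (+ 4 *_) (sym f≡) ⟩
        + 4 * f b             ≡⟨ four-f ⟩
        + (T b ℕ.* T b ℕ.+ Δ) ∎)
        where open ≡-Reasoning
      1≤a₁ : ∀ k → 4 ℕ.* (k ℕ.* a) ≡ T b ℕ.* T b ℕ.+ Δ → 1 ℕ.≤ k
      1≤a₁ zero    eq = ⊥-elim (ℕ.≢-nonZero⁻¹ Δ (ℕP.m+n≡0⇒n≡0 (T b ℕ.* T b) (sym eq)))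
      1≤a₁ (suc _) _  = s≤s z≤n
      a₁<a : a₁ ℕ.< a
      a₁<a with a₁ ℕ.<? a
      ... | yes a₁<a = a₁<a
      ... | no a₁≮a = ⊥-elim (no-reduced-form a (T b) 2≤a 3a²≤Δ T≤a (ℕ∣.divides a₁ T²+Δ≡))
        where
        4a²≤a²+Δ : 4 ℕ.* (a ℕ.* a) ℕ.≤ a ℕ.* a ℕ.+ Δ
        4a²≤a²+Δ = begin
          4 ℕ.* (a ℕ.* a)     ≤⟨ ℕP.*-monoʳ-≤ 4 (ℕP.*-monoˡ-≤ a (ℕP.≮⇒≥ a₁≮a)) ⟩
          4 ℕ.* (a₁ ℕ.* a)    ≡⟨ four-a₁a ⟩
          T b ℕ.* T b ℕ.+ Δ   ≤⟨ ℕP.+-monoˡ-≤ Δ (ℕP.*-mono-≤ T≤a T≤a) ⟩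
          a ℕ.* a ℕ.+ Δ       ∎
          where open ℕP.≤-Reasoning
        3a²≤Δ : 3 ℕ.* (a ℕ.* a) ℕ.≤ Δ
        3a²≤Δ = ℕP.+-cancelˡ-≤ (a ℕ.* a) _ _ 4a²≤a²+Δ
        T²+Δ≡ : T b ℕ.* T b ℕ.+ Δ ≡ a₁ ℕ.* (4 ℕ.* a)
        T²+Δ≡ = trans (sym four-a₁a) (trans (ℕP.*-comm 4 (a₁ ℕ.* a))
                  (trans (ℕP.*-assoc a₁ a 4) (cong (a₁ ℕ.*_) (ℕP.*-comm a 4))))

  generator-exists : ∀ a → 1 ℕ.≤ a → ∀ b → + a ∣ f b → Generator a b
  generator-exists = <-rec _ descend
    where
    descend : ∀ a → (∀ {a₁} → a₁ ℕ.< a → 1 ℕ.≤ a₁ → ∀ b → + a₁ ∣ f b → Generator a₁ b) →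
              1 ℕ.≤ a → ∀ b → + a ∣ f b → Generator a b
    descend 1 _ _ b _ = (+ 1 , + 0) , divides (+ 1 - b * + 0) (sym (ℤP.*-identityʳ _)) , norm-on-ℤ (+ 1)
    descend a@(suc (suc _)) smaller _ b a∣fb = from-representative (reduced-representative a b)
      where
      from-representative : (Σ ℤ λ b₁ → Σ ℤ λ s → (b ≡ b₁ + s * + a) × (T b₁ ℕ.≤ a)) → Generator a b
      from-representative (b₁ , s , b≡ , T≤a) =
        from-cofactor (cofactor-below a (s≤s (s≤s z≤n)) b₁ (f-shift (+ a) b₁ s (subst (λ z → + a ∣ f z) b≡ a∣fb)) T≤a)
        where
        from-cofactor : (Σ ℕ λ a₁ → (f b₁ ≡ + a * + a₁) × (1 ℕ.≤ a₁) × (a₁ ℕ.< a)) → Generator a b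
        from-cofactor (a₁ , f≡ , 1≤a₁ , a₁<a) = shift-back
          (generator-descent a a₁ {{ℕ.>-nonZero 1≤a₁}} b₁ f≡ (smaller a₁<a 1≤a₁ b₁ (divides (+ a) f≡)))
          where
          shift-back : Generator a b₁ → Generator a b
          shift-back (γ , γ∈J , Nγ≡a) = γ , subst (λ z → InJ (+ a) z γ) (sym b≡) (J-shift (+ a) b₁ s γ γ∈J) , Nγ≡a

  ideal-principal : ∀ {a b c} → HNF (a , b , c) → (∀ r z → InL a b c z → InL a b c (r · z)) →
    Σ OK λ α → Generates (a , b , c) α × norm α ≡ + (a ℕ.* c)
  ideal-principal {a} {b} {c} (1≤a , 1≤c , _) closed = from-scaling (ω-closed-hnf 1≤c (closed (+ 0 , + 1)))
    where
    from-scaling : (Σ ℕ λ a₀ → Σ ℕ λ b₀ → (a ≡ a₀ ℕ.* c) × (b ≡ b₀ ℕ.* c) × (+ a₀ ∣ norm (+ b₀ , + 1))) →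
                   Σ OK λ α → Generates (a , b , c) α × norm α ≡ + (a ℕ.* c)
    from-scaling (zero , _ , a≡0 , _ , _) = ⊥-elim (ℕP.<⇒≢ 1≤a (sym a≡0))
    from-scaling (a₀@(suc _) , b₀ , a≡ , b≡ , a₀∣f) =
      scale (+ c) (proj₁ generator) , scaled-generator a b c a₀ b₀ a≡ b≡ a₀∣f generator
      where
      generator : Generator a₀ (+ b₀)
      generator = generator-exists a₀ (s≤s z≤n) (+ b₀) a₀∣f

ι : ℤ → ℚ
ι z = z ℚ./ 1

private
  ι≃ : ∀ z → ℚ.toℚᵘ (ι z) ℚᵘ.≃ mkℚᵘ z 0
  ι≃ z = ℚP.toℚᵘ-fromℚᵘ (mkℚᵘ z 0)

ι-+ : ∀ a b → ι (a ℤ.+ b) ≡ ι a ℚ.+ ι b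
ι-+ a b = ℚP.toℚᵘ-injective (ℚᵘP.≃-trans (ι≃ (a ℤ.+ b)) (ℚᵘP.≃-sym
  (ℚᵘP.≃-trans (ℚP.toℚᵘ-homo-+ (ι a) (ι b)) (ℚᵘP.≃-trans (ℚᵘP.+-cong (ι≃ a) (ι≃ b)) (*≡* (over-1 a b))))))
  where
  over-1 : ∀ a b → (a ℤ.* + 1 ℤ.+ b ℤ.* + 1) ℤ.* + 1 ≡ (a ℤ.+ b) ℤ.* + 1
  over-1 = solve-∀

ι-* : ∀ a b → ι (a ℤ.* b) ≡ ι a ℚ.* ι b
ι-* a b = ℚP.toℚᵘ-injective (ℚᵘP.≃-trans (ι≃ (a ℤ.* b)) (ℚᵘP.≃-sym
  (ℚᵘP.≃-trans (ℚP.toℚᵘ-homo-* (ι a) (ι b)) (ℚᵘP.*-cong (ι≃ a) (ι≃ b)))))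

ι-neg : ∀ a → ι (ℤ.- a) ≡ ℚ.- ι a
ι-neg a = ℚP.toℚᵘ-injective (ℚᵘP.≃-trans (ι≃ (ℤ.- a)) (ℚᵘP.≃-sym
  (ℚᵘP.≃-trans (ℚP.toℚᵘ-homo‿- (ι a)) (ℚᵘP.-‿cong (ι≃ a)))))

ι-sub : ∀ a b → ι (a ℤ.- b) ≡ ι a ℚ.- ι b
ι-sub a b = trans (ι-+ a (ℤ.- b)) (cong (ι a ℚ.+_) (ι-neg b))

ι-injective : ∀ {a b} → ι a ≡ ι b → a ≡ b
ι-injective {a} {b} eq with ℚᵘP.≃-trans (ℚᵘP.≃-sym (ι≃ a)) (ℚᵘP.≃-trans (ℚP.toℚᵘ-cong eq) (ι≃ b))
... | *≡* a*1≡b*1 = trans (sym (ℤP.*-identityʳ a)) (trans a*1≡b*1 (ℤP.*-identityʳ b))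

C₀ C₁ : D → ℤ
C₀ d = proj₁ (ωsq d)
C₁ d = proj₂ (ωsq d)

record Heegner (d : D) : Set where
  field
    c₁ℕ Δ : ℕ
    c₁≡ : C₁ d ≡ + c₁ℕ
    c₁ℕ≤1 : c₁ℕ ℕ.≤ 1
    discriminant : ℤ.- (+ 4 ℤ.* C₀ d) ℤ.- C₁ d ℤ.* C₁ d ≡ + Δ
    5≤Δ : 5 ℕ.≤ Δ
    no-reduced-form : NoReducedForm Δ
    -- ω = s + t √−d
    s t : ℚ
    embed-affine : ∀ x y → embed d (x , y) ≡ (ι x ℚ.+ s ℚ.* ι y , t ℚ.* ι y)
    ι-c₁ : ι (C₁ d) ≡ s ℚ.+ s
    ι-c₀ : ι (C₀ d) ≡ ℚ.- (s ℚ.* s ℚ.+ dℚ d ℚ.* (t ℚ.* t))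

no-reduced-form-at? : ∀ Δ a t → Dec (NoReducedFormAt Δ a t)
no-reduced-form-at? Δ a t =
  (2 ℕ.≤? a) →-dec ((3 ℕ.* (a ℕ.* a) ℕ.≤? Δ) →-dec ((t ℕ.≤? a) →-dec ¬? (4 ℕ.* a ∣ℕ? t ℕ.* t ℕ.+ Δ)))

-- 3a² ≤ Δ ≤ 191 forces a < 8, so a finite search suffices.
no-reduced-form-below-8 : ∀ {Δ} → Δ ℕ.≤ 191 → (∀ (i j : Fin 8) → NoReducedFormAt Δ (toℕ i) (toℕ j)) →
  NoReducedForm Δ
no-reduced-form-below-8 {Δ} Δ≤191 searched a t 2≤a 3a²≤Δ t≤a = by-size (a ℕ.<? 8)
  where
  by-size : Dec (a ℕ.< 8) → ¬ (4 ℕ.* a ∣ℕ t ℕ.* t ℕ.+ Δ)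
  by-size (yes a<8) = subst₂ (NoReducedFormAt Δ) (FinP.toℕ-fromℕ< a<8) (FinP.toℕ-fromℕ< t<8)
                        (searched (fromℕ< a<8) (fromℕ< t<8)) 2≤a 3a²≤Δ t≤a
    where
    t<8 : t ℕ.< 8
    t<8 = ℕP.≤-<-trans t≤a a<8
  by-size (no a≮8) = ⊥-elim (ℕP.<-irrefl refl (ℕP.≤-trans 192≤3a² (ℕP.≤-trans 3a²≤Δ Δ≤191)))
    where
    192≤3a² : 192 ℕ.≤ 3 ℕ.* (a ℕ.* a)
    192≤3a² = ℕP.*-monoʳ-≤ 3 (ℕP.*-mono-≤ (ℕP.≮⇒≥ a≮8) (ℕP.≮⇒≥ a≮8))

search? : ∀ Δ → Dec (∀ (i j : Fin 8) → NoReducedFormAt Δ (toℕ i) (toℕ j))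
search? Δ = FinP.all? λ i → FinP.all? λ j → no-reduced-form-at? Δ (toℕ i) (toℕ j)

no-reduced-form-by-search : ∀ Δ → Δ ℕ.≤ 191 → True (search? Δ) → NoReducedForm Δ
no-reduced-form-by-search Δ Δ≤191 found = no-reduced-form-below-8 Δ≤191 (toWitness found)

heegner : (d : D) → Heegner d
heegner d2 = record
  { c₁ℕ = 0 ; Δ = 8 ; c₁≡ = refl ; c₁ℕ≤1 = ℕ.z≤n ; discriminant = refl ; 5≤Δ = ℕP.m≤m+n 5 3
  ; no-reduced-form = no-reduced-form-by-search 8 (ℕP.m≤m+n 8 183) _
  ; s = 0ℚ ; t = 1ℚ ; ι-c₁ = refl ; ι-c₀ = refl
  ; embed-affine = λ x y → sym (cong₂ _,_ (trans (cong (ι x ℚ.+_) (ℚP.*-zeroˡ (ι y))) (ℚP.+-identityʳ (ι x)))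
                                          (ℚP.*-identityˡ (ι y))) }
heegner d7 = record
  { c₁ℕ = 1 ; Δ = 7 ; c₁≡ = refl ; c₁ℕ≤1 = ℕP.≤-refl ; discriminant = refl ; 5≤Δ = ℕP.m≤m+n 5 2
  ; no-reduced-form = no-reduced-form-by-search 7 (ℕP.m≤m+n 7 184) _
  ; s = ½ ; t = ½ ; ι-c₁ = refl ; ι-c₀ = refl ; embed-affine = λ _ _ → refl }
heegner d11 = record
  { c₁ℕ = 1 ; Δ = 11 ; c₁≡ = refl ; c₁ℕ≤1 = ℕP.≤-refl ; discriminant = refl ; 5≤Δ = ℕP.m≤m+n 5 6
  ; no-reduced-form = no-reduced-form-by-search 11 (ℕP.m≤m+n 11 180) _
  ; s = ½ ; t = ½ ; ι-c₁ = refl ; ι-c₀ = refl ; embed-affine = λ _ _ → refl }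
heegner d19 = record
  { c₁ℕ = 1 ; Δ = 19 ; c₁≡ = refl ; c₁ℕ≤1 = ℕP.≤-refl ; discriminant = refl ; 5≤Δ = ℕP.m≤m+n 5 14
  ; no-reduced-form = no-reduced-form-by-search 19 (ℕP.m≤m+n 19 172) _
  ; s = ½ ; t = ½ ; ι-c₁ = refl ; ι-c₀ = refl ; embed-affine = λ _ _ → refl }
heegner d43 = record
  { c₁ℕ = 1 ; Δ = 43 ; c₁≡ = refl ; c₁ℕ≤1 = ℕP.≤-refl ; discriminant = refl ; 5≤Δ = ℕP.m≤m+n 5 38
  ; no-reduced-form = no-reduced-form-by-search 43 (ℕP.m≤m+n 43 148) _
  ; s = ½ ; t = ½ ; ι-c₁ = refl ; ι-c₀ = refl ; embed-affine = λ _ _ → refl }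
heegner d67 = record
  { c₁ℕ = 1 ; Δ = 67 ; c₁≡ = refl ; c₁ℕ≤1 = ℕP.≤-refl ; discriminant = refl ; 5≤Δ = ℕP.m≤m+n 5 62
  ; no-reduced-form = no-reduced-form-by-search 67 (ℕP.m≤m+n 67 124) _
  ; s = ½ ; t = ½ ; ι-c₁ = refl ; ι-c₀ = refl ; embed-affine = λ _ _ → refl }
heegner d163 = record
  { c₁ℕ = 1 ; Δ = 163 ; c₁≡ = refl ; c₁ℕ≤1 = ℕP.≤-refl ; discriminant = refl ; 5≤Δ = ℕP.m≤m+n 5 158
  ; no-reduced-form = no-reduced-form-by-search 163 (ℕP.m≤m+n 163 28) _
  ; s = ½ ; t = ½ ; ι-c₁ = refl ; ι-c₀ = refl ; embed-affine = λ _ _ → refl }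

module Embedding (d : D) (H : Heegner d) where

  open Heegner H
  open QuadraticOrder (C₀ d) (C₁ d)

  square : OK → Kq
  square v = sqK d (embed d v)

  ι-norm : ∀ x y → ι (norm (x , y)) ≡ ι x ℚ.* ι x ℚ.+ ι (C₁ d) ℚ.* ι x ℚ.* ι y ℚ.- ι (C₀ d) ℚ.* ι y ℚ.* ι y
  ι-norm x y = trans (ι-sub (x ℤ.* x ℤ.+ c₁ ℤ.* x ℤ.* y) (c₀ ℤ.* y ℤ.* y))
    (cong₂ ℚ._-_ (trans (ι-+ (x ℤ.* x) (c₁ ℤ.* x ℤ.* y)) (cong₂ ℚ._+_ (ι-* x x) (trans (ι-* (c₁ ℤ.* x) y) (cong (ℚ._* ι y) (ι-* c₁ x)))))
                 (trans (ι-* (c₀ ℤ.* y) y) (cong (ℚ._* ι y) (ι-* c₀ y))))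
    where
    c₀ c₁ : ℤ
    c₀ = C₀ d
    c₁ = C₁ d

  ip≡ι-norm : ∀ v → ip d v ≡ ι (norm v)
  ip≡ι-norm (x , y) = begin
    ip d (x , y)
      ≡⟨ cong (λ p → proj₁ p ℚ.* proj₁ p ℚ.+ dℚ d ℚ.* (proj₂ p ℚ.* proj₂ p)) (embed-affine x y) ⟩
    (ι x ℚ.+ s ℚ.* ι y) ℚ.* (ι x ℚ.+ s ℚ.* ι y) ℚ.+ dℚ d ℚ.* ((t ℚ.* ι y) ℚ.* (t ℚ.* ι y))
      ≡⟨ expand (ι x) (ι y) s t (dℚ d) ⟩
    ι x ℚ.* ι x ℚ.+ (s ℚ.+ s) ℚ.* ι x ℚ.* ι y ℚ.- (ℚ.- (s ℚ.* s ℚ.+ dℚ d ℚ.* (t ℚ.* t))) ℚ.* ι y ℚ.* ι y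
      ≡⟨ sym (cong₂ (λ c₁ c₀ → ι x ℚ.* ι x ℚ.+ c₁ ℚ.* ι x ℚ.* ι y ℚ.- c₀ ℚ.* ι y ℚ.* ι y) ι-c₁ ι-c₀) ⟩
    ι x ℚ.* ι x ℚ.+ ι (C₁ d) ℚ.* ι x ℚ.* ι y ℚ.- ι (C₀ d) ℚ.* ι y ℚ.* ι y
      ≡⟨ sym (ι-norm x y) ⟩
    ι (norm (x , y)) ∎
    where
    open ≡-Reasoning
    expand : ∀ X Y s t D → (X ℚ.+ s ℚ.* Y) ℚ.* (X ℚ.+ s ℚ.* Y) ℚ.+ D ℚ.* ((t ℚ.* Y) ℚ.* (t ℚ.* Y))
      ≡ X ℚ.* X ℚ.+ (s ℚ.+ s) ℚ.* X ℚ.* Y ℚ.- (ℚ.- (s ℚ.* s ℚ.+ D ℚ.* (t ℚ.* t))) ℚ.* Y ℚ.* Y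
    expand = solve 5 (λ X Y s t D → (X :+ s :* Y) :* (X :+ s :* Y) :+ D :* ((t :* Y) :* (t :* Y))
      := X :* X :+ (s :+ s) :* X :* Y :- (:- (s :* s :+ D :* (t :* t))) :* Y :* Y) refl

  square-affine : ∀ x y → square (x , y) ≡ sqK d (ι x ℚ.+ s ℚ.* ι y , t ℚ.* ι y)
  square-affine x y = cong (sqK d) (embed-affine x y)

  square-neg : ∀ v → square (neg v) ≡ square v
  square-neg (x , y) = begin
    square (ℤ.- x , ℤ.- y)                                    ≡⟨ square-affine (ℤ.- x) (ℤ.- y) ⟩
    sqK d (ι (ℤ.- x) ℚ.+ s ℚ.* ι (ℤ.- y) , t ℚ.* ι (ℤ.- y))   ≡⟨ cong₂ (λ X Y → sqK d (X ℚ.+ s ℚ.* Y , t ℚ.* Y)) (ι-neg x) (ι-neg y) ⟩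
    sqK d (ℚ.- ι x ℚ.+ s ℚ.* ℚ.- ι y , t ℚ.* ℚ.- ι y)         ≡⟨ cong₂ _,_ (even₁ (ι x) (ι y) s t (dℚ d)) (even₂ (ι x) (ι y) s t) ⟩
    sqK d (ι x ℚ.+ s ℚ.* ι y , t ℚ.* ι y)                     ≡⟨ sym (square-affine x y) ⟩
    square (x , y)                                            ∎
    where
    open ≡-Reasoning
    even₁ : ∀ X Y s t D → (ℚ.- X ℚ.+ s ℚ.* ℚ.- Y) ℚ.* (ℚ.- X ℚ.+ s ℚ.* ℚ.- Y) ℚ.- D ℚ.* ((t ℚ.* ℚ.- Y) ℚ.* (t ℚ.* ℚ.- Y))
      ≡ (X ℚ.+ s ℚ.* Y) ℚ.* (X ℚ.+ s ℚ.* Y) ℚ.- D ℚ.* ((t ℚ.* Y) ℚ.* (t ℚ.* Y))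
    even₁ = solve 5 (λ X Y s t D → (:- X :+ s :* :- Y) :* (:- X :+ s :* :- Y) :- D :* ((t :* :- Y) :* (t :* :- Y))
      := (X :+ s :* Y) :* (X :+ s :* Y) :- D :* ((t :* Y) :* (t :* Y))) refl
    even₂ : ∀ X Y s t → (+ 2 ℚ./ 1) ℚ.* ((ℚ.- X ℚ.+ s ℚ.* ℚ.- Y) ℚ.* (t ℚ.* ℚ.- Y))
      ≡ (+ 2 ℚ./ 1) ℚ.* ((X ℚ.+ s ℚ.* Y) ℚ.* (t ℚ.* Y))
    even₂ = solve 4 (λ X Y s t → con (+ 2 ℚ./ 1) :* ((:- X :+ s :* :- Y) :* (t :* :- Y))
      := con (+ 2 ℚ./ 1) :* ((X :+ s :* Y) :* (t :* Y))) refl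

  Im-square-conj : ∀ v → proj₂ (square (conj v)) ≡ ℚ.- proj₂ (square v)
  Im-square-conj (x , y) = begin
    proj₂ (square (x ℤ.+ C₁ d ℤ.* y , ℤ.- y))
      ≡⟨ cong proj₂ (square-affine (x ℤ.+ C₁ d ℤ.* y) (ℤ.- y)) ⟩
    proj₂ (sqK d (ι (x ℤ.+ C₁ d ℤ.* y) ℚ.+ s ℚ.* ι (ℤ.- y) , t ℚ.* ι (ℤ.- y)))
      ≡⟨ cong₂ (λ X Y → proj₂ (sqK d (X ℚ.+ s ℚ.* Y , t ℚ.* Y)))
           (trans (ι-+ x _) (cong (ι x ℚ.+_) (trans (ι-* (C₁ d) y) (cong (ℚ._* ι y) ι-c₁)))) (ι-neg y) ⟩
    proj₂ (sqK d (ι x ℚ.+ (s ℚ.+ s) ℚ.* ι y ℚ.+ s ℚ.* ℚ.- ι y , t ℚ.* ℚ.- ι y))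
      ≡⟨ odd (ι x) (ι y) s t ⟩
    ℚ.- proj₂ (sqK d (ι x ℚ.+ s ℚ.* ι y , t ℚ.* ι y))
      ≡⟨ cong (λ p → ℚ.- proj₂ p) (sym (square-affine x y)) ⟩
    ℚ.- proj₂ (square (x , y)) ∎
    where
    open ≡-Reasoning
    odd : ∀ X Y s t → (+ 2 ℚ./ 1) ℚ.* ((X ℚ.+ (s ℚ.+ s) ℚ.* Y ℚ.+ s ℚ.* ℚ.- Y) ℚ.* (t ℚ.* ℚ.- Y))
      ≡ ℚ.- ((+ 2 ℚ./ 1) ℚ.* ((X ℚ.+ s ℚ.* Y) ℚ.* (t ℚ.* Y)))
    odd = solve 4 (λ X Y s t → con (+ 2 ℚ./ 1) :* ((X :+ (s :+ s) :* Y :+ s :* :- Y) :* (t :* :- Y))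
      := :- (con (+ 2 ℚ./ 1) :* ((X :+ s :* Y) :* (t :* Y)))) refl

  P₁≡½Re-square : ∀ v → P₁ d v ≡ ½ ℚ.* proj₁ (square v)
  P₁≡½Re-square v = refl

  P₁-zero : P₁ d (+ 0 , + 0) ≡ 0ℚ
  P₁-zero = trans (cong (λ p → ½ ℚ.* proj₁ p) (square-affine (+ 0) (+ 0))) (vanish s t (dℚ d))
    where
    vanish : ∀ s t D → ½ ℚ.* ((0ℚ ℚ.+ s ℚ.* 0ℚ) ℚ.* (0ℚ ℚ.+ s ℚ.* 0ℚ) ℚ.- D ℚ.* ((t ℚ.* 0ℚ) ℚ.* (t ℚ.* 0ℚ))) ≡ 0ℚ
    vanish = solve 3 (λ s t D → con ½ :* ((con 0ℚ :+ s :* con 0ℚ) :* (con 0ℚ :+ s :* con 0ℚ) :- D :* ((t :* con 0ℚ) :* (t :* con 0ℚ))) := con 0ℚ) refl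

-- Ideals of norm n and vectors of norm n

sumK-split : ∀ {A : Set} (f : A → Kq) xs →
  sumK f xs ≡ (sumℚ (λ x → proj₁ (f x)) xs , sumℚ (λ x → proj₂ (f x)) xs)
sumK-split f []       = refl
sumK-split f (x ∷ xs) = cong (f x +K_) (sumK-split f xs)

sumℚ-↭ : ∀ {A : Set} (f : A → ℚ) {xs ys} → xs ↭ ys → sumℚ f xs ≡ sumℚ f ys
sumℚ-↭ f ↭.refl         = refl
sumℚ-↭ f (↭.prep x p)   = cong (f x ℚ.+_) (sumℚ-↭ f p)
sumℚ-↭ f (↭.swap x y p) = trans (cong (λ s → f x ℚ.+ (f y ℚ.+ s)) (sumℚ-↭ f p)) (exchange (f x) (f y) _)
  where
  exchange : ∀ a b c → a ℚ.+ (b ℚ.+ c) ≡ b ℚ.+ (a ℚ.+ c)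
  exchange = solve 3 (λ a b c → a :+ (b :+ c) := b :+ (a :+ c)) refl
sumℚ-↭ f (↭.trans p q)  = trans (sumℚ-↭ f p) (sumℚ-↭ f q)

sumℚ-map : ∀ {A B : Set} (f : B → ℚ) (g : A → B) xs → sumℚ f (map g xs) ≡ sumℚ (λ x → f (g x)) xs
sumℚ-map f g []       = refl
sumℚ-map f g (x ∷ xs) = cong (f (g x) ℚ.+_) (sumℚ-map f g xs)

sumℚ-cong : ∀ {A : Set} {f g : A → ℚ} → (∀ x → f x ≡ g x) → ∀ xs → sumℚ f xs ≡ sumℚ g xs
sumℚ-cong f≡g []       = refl
sumℚ-cong f≡g (x ∷ xs) = cong₂ ℚ._+_ (f≡g x) (sumℚ-cong f≡g xs)

sumℚ-neg : ∀ {A : Set} (f : A → ℚ) xs → sumℚ (λ x → ℚ.- f x) xs ≡ ℚ.- sumℚ f xs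
sumℚ-neg f []       = refl
sumℚ-neg f (x ∷ xs) = trans (cong (ℚ.- f x ℚ.+_) (sumℚ-neg f xs)) (distribute (f x) (sumℚ f xs))
  where
  distribute : ∀ a b → ℚ.- a ℚ.+ ℚ.- b ≡ ℚ.- (a ℚ.+ b)
  distribute = solve 2 (λ a b → :- a :+ :- b := :- (a :+ b)) refl

sumℚ-½ : ∀ {A : Set} (f : A → ℚ) xs → sumℚ (λ x → ½ ℚ.* f x) xs ≡ ½ ℚ.* sumℚ f xs
sumℚ-½ f []       = refl
sumℚ-½ f (x ∷ xs) = trans (cong (½ ℚ.* f x ℚ.+_) (sumℚ-½ f xs)) (distribute (f x) (sumℚ f xs))
  where
  distribute : ∀ a b → ½ ℚ.* a ℚ.+ ½ ℚ.* b ≡ ½ ℚ.* (a ℚ.+ b)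
  distribute = solve 2 (λ a b → con ½ :* a :+ con ½ :* b := con ½ :* (a :+ b)) refl

x≡½[x+x] : ∀ x → x ≡ ½ ℚ.* (x ℚ.+ x)
x≡½[x+x] = solve 1 (λ x → x := con ½ :* (x :+ x)) refl

x≡-x⇒x≡0 : ∀ x → x ≡ ℚ.- x → x ≡ 0ℚ
x≡-x⇒x≡0 x x≡-x = trans (x≡½[x+x] x) (trans (cong (λ y → ½ ℚ.* (x ℚ.+ y)) x≡-x) (cancel x))
  where
  cancel : ∀ x → ½ ℚ.* (x ℚ.+ ℚ.- x) ≡ 0ℚ
  cancel = solve 1 (λ x → con ½ :* (x :+ :- x) := con 0ℚ) refl

module Correspondence (d : D) where

  open Heegner (heegner d)
  open QuadraticOrder (C₀ d) (C₁ d)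
  open Lattices (C₀ d) (C₁ d)
  open PositiveDefinite (C₀ d) (C₁ d) Δ discriminant
  open Embedding d (heegner d) public

  instance
    Δ≢0 : ℕ.NonZero Δ
    Δ≢0 = ℕ.>-nonZero (ℕP.≤-trans (s≤s z≤n) 5≤Δ)

  open ClassNumberOne (C₀ d) (C₁ d) c₁ℕ Δ c₁≡ c₁ℕ≤1 discriminant no-reduced-form

  Ideal : Set
  Ideal = ℕ × ℕ × ℕ

  principal : ∀ I → IsIdealHNF d I → Σ OK λ α → Generates I α × norm α ≡ + normI I
  principal (a , b , c) (1≤a , 1≤c , b<a , closed) = ideal-principal (1≤a , 1≤c , b<a) closed

  generator : ∀ I → IsIdealHNF d I → OK
  generator I p = proj₁ (principal I p)

  ±generators : (Is : List Ideal) → All (IsIdealHNF d) Is → List OK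
  ±generators []       []       = []
  ±generators (I ∷ Is) (p ∷ ps) = generator I p ∷ neg (generator I p) ∷ ±generators Is ps

  ∈-±generators⁻ : ∀ Is ps {v} → v ∈ ±generators Is ps → Σ Ideal λ I → I ∈ Is × Σ (IsIdealHNF d I) λ p → v ±≡ generator I p
  ∈-±generators⁻ (I ∷ Is) (p ∷ ps) (here v≡)         = I , here refl , p , inj₁ v≡
  ∈-±generators⁻ (I ∷ Is) (p ∷ ps) (there (here v≡)) = I , here refl , p , inj₂ v≡
  ∈-±generators⁻ (I ∷ Is) (p ∷ ps) (there (there v∈)) with ∈-±generators⁻ Is ps v∈
  ... | J , J∈ , q , v±≡ = J , there J∈ , q , v±≡

  ∈-±generators⁺ : ∀ Is ps {I} (I∈ : I ∈ Is) → let α = generator I (All.lookup ps I∈) in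
    α ∈ ±generators Is ps × neg α ∈ ±generators Is ps
  ∈-±generators⁺ (J ∷ Is) (p ∷ ps) (here refl) = here refl , there (here refl)
  ∈-±generators⁺ (J ∷ Is) (p ∷ ps) (there I∈) with ∈-±generators⁺ Is ps I∈
  ... | α∈ , -α∈ = there (there α∈) , there (there -α∈)

  generator-determines-ideal : ∀ I J p q → generator I p ±≡ generator J q → I ≡ J
  generator-determines-ideal I@(_ , _ , _) J@(_ , _ , _) p@(1≤a , 1≤c , b<a , _) q@(1≤a′ , 1≤c′ , b′<a′ , _) α±≡β =
    hnf-unique (1≤a , 1≤c , b<a) (1≤a′ , 1≤c′ , b′<a′)
      (±-associates-generate (proj₁ (proj₂ (principal I p))) (proj₁ (proj₂ (principal J q))) α±≡β)
      (±-associates-generate (proj₁ (proj₂ (principal J q))) (proj₁ (proj₂ (principal I p))) (±-sym α±≡β))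

  generator≢neg : ∀ I p → generator I p ≢ neg (generator I p)
  generator≢neg I@(a , _ , c) p@(1≤a , 1≤c , _) α≡-α = ℕP.<⇒≢ (ℕP.*-mono-≤ 1≤a 1≤c) (sym (ℤP.+-injective (begin
    + (a ℕ.* c)         ≡⟨ sym (proj₂ (proj₂ (principal I p))) ⟩
    norm α              ≡⟨ cong norm α≡0 ⟩
    norm (+ 0 , + 0)    ≡⟨ norm-on-ℤ (+ 0) ⟩
    + 0                 ∎)))
    where
    open ≡-Reasoning
    α : OK
    α = generator I p
    i≡-i⇒i≡0 : ∀ {i} → i ≡ ℤ.- i → i ≡ + 0
    i≡-i⇒i≡0 {+ 0}        _ = refl
    i≡-i⇒i≡0 {+ suc _}    ()
    i≡-i⇒i≡0 {ℤ.-[1+ _ ]} ()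
    α≡0 : α ≡ (+ 0 , + 0)
    α≡0 = cong₂ _,_ (i≡-i⇒i≡0 (cong proj₁ α≡-α)) (i≡-i⇒i≡0 (cong proj₂ α≡-α))

  ±generators-unique : ∀ Is ps → Unique Is → Unique (±generators Is ps)
  ±generators-unique []       []       AllPairs.[]                 = AllPairs.[]
  ±generators-unique (I ∷ Is) (p ∷ ps) (I∉Is AllPairs.∷ Is-unique) =
    All.tabulate α≢ AllPairs.∷ All.tabulate -α≢ AllPairs.∷ ±generators-unique Is ps Is-unique
    where
    α : OK
    α = generator I p
    clash : ∀ {w} → w ∈ ±generators Is ps → α ±≡ w → ⊥
    clash w∈ α±≡w with ∈-±generators⁻ Is ps w∈
    ... | J , J∈ , q , w±≡ = All.lookup I∉Is J∈ (generator-determines-ideal I J p q (±-trans α±≡w w±≡))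
    α≢ : ∀ {w} → w ∈ neg α ∷ ±generators Is ps → α ≢ w
    α≢ (here refl) = generator≢neg I p
    α≢ (there w∈) α≡w = clash w∈ (inj₁ α≡w)
    -α≢ : ∀ {w} → w ∈ ±generators Is ps → neg α ≢ w
    -α≢ w∈ -α≡w = clash w∈ (inj₂ (trans (sym (neg-involutive α)) (cong neg -α≡w)))

  EnumeratesIdeals : ℕ → List Ideal → Set
  EnumeratesIdeals n Is = ∀ I → (I ∈ Is → IsIdealHNF d I × normI I ≡ n) × (IsIdealHNF d I × normI I ≡ n → I ∈ Is)

  EnumeratesVectors : ℕ → List OK → Set
  EnumeratesVectors n vs = ∀ v → (v ∈ vs → ip d v ≡ embedℕ n) × (ip d v ≡ embedℕ n → v ∈ vs)

  ideals-are-ideals : ∀ {n} Is → EnumeratesIdeals n Is → All (IsIdealHNF d) Is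
  ideals-are-ideals Is enum = All.tabulate λ {I} I∈ → proj₁ (proj₁ (enum I) I∈)

  ±generators↭vectors : ∀ n Is vs (enumI : EnumeratesIdeals (suc n) Is) → EnumeratesVectors (suc n) vs →
    Unique Is → Unique vs → ±generators Is (ideals-are-ideals Is enumI) ↭ vs
  ±generators↭vectors n Is vs enumI enumV Is-unique vs-unique =
    ∼bag⇒↭ (unique∧set⇒bag (±generators-unique Is ps Is-unique) vs-unique (mk⇔ into from))
    where
    ps : All (IsIdealHNF d) Is
    ps = ideals-are-ideals Is enumI
    into : ∀ {w} → w ∈ ±generators Is ps → w ∈ vs
    into w∈ with ∈-±generators⁻ Is ps w∈
    ... | J , J∈ , q , w±≡ = proj₂ (enumV _) (trans (ip≡ι-norm _) (cong ι (trans (norm-± w±≡)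
                               (trans (proj₂ (proj₂ (principal J q))) (cong +_ (proj₂ (proj₁ (enumI J) J∈)))))))
      where
      norm-± : ∀ {w α} → w ±≡ α → norm w ≡ norm α
      norm-± (inj₁ refl) = refl
      norm-± {α = α} (inj₂ refl) = norm-neg α
    from : ∀ {w} → w ∈ vs → w ∈ ±generators Is ps
    from {w} w∈ = from-hnf (principal-hnf w n N≡)
      where
      N≡ : norm w ≡ + suc n
      N≡ = ι-injective (trans (sym (ip≡ι-norm w)) (proj₁ (enumV w) w∈))
      from-hnf : Principal-HNF w (suc n) → w ∈ ±generators Is ps
      from-hnf ((a , b , c) , w-gen , (1≤a , 1≤c , b<a) , normI≡) = pick (generators-associate 5≤Δ α-gen w-gen N≡)
        where
        I∈ : (a , b , c) ∈ Is
        I∈ = proj₂ (enumI (a , b , c)) ((1≤a , 1≤c , b<a , generated-closed {a} {b} {c} {w} w-gen) , normI≡)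
        α-gen : Generates (a , b , c) (generator (a , b , c) (All.lookup ps I∈))
        α-gen = proj₁ (proj₂ (principal (a , b , c) (All.lookup ps I∈)))
        pick : w ±≡ generator (a , b , c) (All.lookup ps I∈) → w ∈ ±generators Is ps
        pick (inj₁ w≡α)  = subst (_∈ ±generators Is ps) (sym w≡α) (proj₁ (∈-±generators⁺ Is ps I∈))
        pick (inj₂ w≡-α) = subst (_∈ ±generators Is ps) (sym w≡-α) (proj₂ (∈-±generators⁺ Is ps I∈))

  conj-vectors↭ : ∀ n vs → EnumeratesVectors n vs → Unique vs → map conj vs ↭ vs
  conj-vectors↭ n vs enumV vs-unique =
    ∼bag⇒↭ (unique∧set⇒bag (Unique.map⁺ conj-injective vs-unique) vs-unique (mk⇔ into from))
    where
    ip-conj : ∀ v → ip d (conj v) ≡ ip d v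
    ip-conj v = trans (ip≡ι-norm (conj v)) (trans (cong ι (norm-conj v)) (sym (ip≡ι-norm v)))
    into : ∀ {w} → w ∈ map conj vs → w ∈ vs
    into w∈ with ∈-map⁻ conj w∈
    ... | v , v∈ , refl = proj₂ (enumV (conj v)) (trans (ip-conj v) (proj₁ (enumV v) v∈))
    from : ∀ {w} → w ∈ vs → w ∈ map conj vs
    from {w} w∈ = subst (_∈ map conj vs) (conj-involutive w)
      (∈-map⁺ conj (proj₂ (enumV (conj w)) (trans (ip-conj w) (proj₁ (enumV w) w∈))))

  -- Conjugation permutes the vectors of norm n and negates Im v².
  Σ-Im-square≡0 : ∀ n vs → EnumeratesVectors n vs → Unique vs → sumℚ (λ v → proj₂ (square v)) vs ≡ 0ℚ
  Σ-Im-square≡0 n vs enumV vs-unique = x≡-x⇒x≡0 _ (begin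
    sumℚ Im² vs                         ≡⟨ sym (sumℚ-↭ Im² (conj-vectors↭ n vs enumV vs-unique)) ⟩
    sumℚ Im² (map conj vs)              ≡⟨ sumℚ-map Im² conj vs ⟩
    sumℚ (λ v → Im² (conj v)) vs        ≡⟨ sumℚ-cong Im-square-conj vs ⟩
    sumℚ (λ v → ℚ.- Im² v) vs           ≡⟨ sumℚ-neg Im² vs ⟩
    ℚ.- sumℚ Im² vs                     ∎)
    where
    open ≡-Reasoning
    Im² : OK → ℚ
    Im² v = proj₂ (square v)

  Σ-P₁-norm-zero : ∀ vs → (∀ {v} → v ∈ vs → ip d v ≡ embedℕ 0) → sumℚ (P₁ d) vs ≡ 0ℚ
  Σ-P₁-norm-zero []       _      = refl
  Σ-P₁-norm-zero (v ∷ vs) norm≡0 =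
    cong₂ ℚ._+_ (trans (cong (P₁ d) v≡0) P₁-zero) (Σ-P₁-norm-zero vs (λ v∈ → norm≡0 (there v∈)))
    where
    v≡0 : v ≡ (+ 0 , + 0)
    v≡0 = norm≡0⇒≡0 v (ι-injective (trans (sym (ip≡ι-norm v)) (norm≡0 (here refl))))

  module _ (φ : Ideal → Kq) (φ≡ : ∀ I α → IsIdealHNF d I → IsPrincipalGen d I α → φ I ≡ square α) where

    Σ-square-±generators : (k : Kq → ℚ) → ∀ Is ps →
      sumℚ (λ v → k (square v)) (±generators Is ps) ≡ sumℚ (λ I → k (φ I)) Is ℚ.+ sumℚ (λ I → k (φ I)) Is
    Σ-square-±generators k []       []       = refl
    Σ-square-±generators k (I ∷ Is) (p ∷ ps) = begin
      k (square α) ℚ.+ (k (square (neg α)) ℚ.+ sumℚ (λ v → k (square v)) (±generators Is ps))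
        ≡⟨ cong₂ (λ x y → x ℚ.+ (y ℚ.+ sumℚ (λ v → k (square v)) (±generators Is ps))) kα≡ (trans (cong k (square-neg α)) kα≡) ⟩
      k (φ I) ℚ.+ (k (φ I) ℚ.+ sumℚ (λ v → k (square v)) (±generators Is ps))
        ≡⟨ cong (λ r → k (φ I) ℚ.+ (k (φ I) ℚ.+ r)) (Σ-square-±generators k Is ps) ⟩
      k (φ I) ℚ.+ (k (φ I) ℚ.+ (rest ℚ.+ rest))
        ≡⟨ interleave (k (φ I)) rest ⟩
      (k (φ I) ℚ.+ rest) ℚ.+ (k (φ I) ℚ.+ rest) ∎
      where
      open ≡-Reasoning
      α : OK
      α = generator I p
      rest : ℚ
      rest = sumℚ (λ J → k (φ J)) Is
      kα≡ : k (square α) ≡ k (φ I)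
      kα≡ = cong k (sym (φ≡ I α p (proj₁ (proj₂ (principal I p)))))
      interleave : ∀ a A → a ℚ.+ (a ℚ.+ (A ℚ.+ A)) ≡ (a ℚ.+ A) ℚ.+ (a ℚ.+ A)
      interleave = solve 2 (λ a A → a :+ (a :+ (A :+ A)) := (a :+ A) :+ (a :+ A)) refl

lemma3p1 : (d : D) (φ : ℕ × ℕ × ℕ → Kq)
    → ((I : ℕ × ℕ × ℕ) (α : OK) → IsIdealHNF d I → IsPrincipalGen d I α → φ I ≡ sqK d (embed d α))
    → (n : ℕ)
    → (ideals : List (ℕ × ℕ × ℕ)) → Unique ideals
    → ((I : ℕ × ℕ × ℕ) → (I ∈ ideals → IsIdealHNF d I × normI I ≡ n) × (IsIdealHNF d I × normI I ≡ n → I ∈ ideals))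
    → (vs : List OK) → Unique vs
    → ((v : OK) → (v ∈ vs → ip d v ≡ embedℕ n) × (ip d v ≡ embedℕ n → v ∈ vs))
    → sumK φ ideals ≡ (sumℚ (P₁ d) vs , 0ℚ)
lemma3p1 d φ φ≡ zero [] _ _ vs _ enumV =
  cong (_, 0ℚ) (sym (Σ-P₁-norm-zero vs (λ {v} v∈ → proj₁ (enumV v) v∈)))
  where open Correspondence d
lemma3p1 d φ φ≡ zero (I ∷ _) _ enumI _ _ _ with proj₁ (enumI I) (here refl)
... | (1≤a , 1≤c , _) , ac≡0 = ⊥-elim (ℕP.<⇒≢ (ℕP.*-mono-≤ 1≤a 1≤c) (sym ac≡0))
lemma3p1 d φ φ≡ (suc n) ideals ideals-unique enumI vs vs-unique enumV =
  trans (sumK-split φ ideals) (cong₂ _,_ real imaginary)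
  where
  open Correspondence d
  twice : ∀ k → sumℚ (λ I → k (φ I)) ideals ℚ.+ sumℚ (λ I → k (φ I)) ideals ≡ sumℚ (λ v → k (square v)) vs
  twice k = trans (sym (Σ-square-±generators φ φ≡ k ideals _))
                  (sumℚ-↭ _ (±generators↭vectors n ideals vs enumI enumV ideals-unique vs-unique))
  real : sumℚ (λ I → proj₁ (φ I)) ideals ≡ sumℚ (P₁ d) vs
  real = trans (x≡½[x+x] _) (trans (cong (½ ℚ.*_) (twice proj₁))
           (sym (trans (sumℚ-cong P₁≡½Re-square vs) (sumℚ-½ _ vs))))
  imaginary : sumℚ (λ I → proj₂ (φ I)) ideals ≡ 0ℚ
  imaginary = trans (x≡½[x+x] _) (cong (½ ℚ.*_) (trans (twice proj₂) (Σ-Im-square≡0 (suc n) vs enumV vs-unique)))
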